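{- Let $\mathcal N$ be the two-sided ideal of $(\mathcal H,\ast)$ generated by $N$. Then $\mathcal N$ is a Hopf ideal, and for any commutative unital $\mathbb Q$-algebra $\mathcal A$ the transfer group $T_{\mathcal A}$ is isomorphic to the group of $\mathcal A$-valued characters (unital algebra morphisms $\mathcal H/\mathcal N\to\mathcal A$, with the convolution product induced by the coproduct) of the Hopf algebra $\mathcal H/\mathcal N$.
   Context: $Y=\{z_k:k\in\mathbb Z\}$, and $\mathcal H=\langle Y\rangle_{\mathbb Q}$ is the $\mathbb Q$-vector space spanned by words in $Y$ (empty word $\mathbf 1$), equipped with the quasi-shuffle product $\ast$ defined by $\mathbf 1\ast w=w\ast\mathbf 1=w$ and $z_mu\ast z_nv=z_m(u\ast z_nv)+z_n(z_mu\ast v)+z_{m+n}(u\ast v)$; deconcatenation coproduct $\Delta(w)=\sum_{uv=w}u\otimes v$; counit $\varepsilon(\mathbf 1)=1$, $\varepsilon(w)=0$ for nonempty $w$; this is a Hopf algebra. A word $z_{k_1}\cdots z_{k_n}$ ($n\ge1$) is non-singular if $k_1\neq1$, $k_1+k_2\notin\{2,1,0,-2,-4,\ldots\}$ (when $n\ge2$), and $k_1+\cdots+k_j\notin\mathbb Z_{\le j}$ for all $3\le j\le n$; $N$ is the $\mathbb Q$-span of non-singular words. $G_{\mathcal A}$ is the group of unital algebra morphisms $(\mathcal H,\ast)\to\mathcal A$ under convolution $\phi\star\psi=m_{\mathcal A}\circ(\phi\otimes\psi)\circ\Delta$, and the transfer group is $T_{\mathcal A}=\{\phi\in G_{\mathcal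 A}:\phi|_N=0\}$. -}

module Defs where

open import Level using (Level; _⊔_) renaming (suc to lsuc)
open import Data.Nat using (ℕ; zero; suc)
open import Data.Integer as ℤ using (ℤ; +_)
open import Data.Integer.Divisibility using (_∣_)
open import Data.Rational as ℚ using (ℚ; 0ℚ; 1ℚ)
open import Data.Rational.Properties using (+-*-commutativeRing)
open import Data.List using (List; []; _∷_; _++_; map; concatMap; foldr; length)
open import Data.List.Properties using (≡-dec)
open import Data.Product using (Σ; _×_; _,_)
open import Data.Sum using (_⊎_)
open import Data.Unit using (⊤)
open import Data.Empty using (⊥)
open import Relation.Nullary using (¬_; yes; no)
open import Relation.Binary.PropositionalEquality using (_≡_; _≢_)
open import Algebra.Bundles using (CommutativeRing)
open import Algebra.Morphism.Structures using (module RingMorphisms)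

-- Words over Y = { z_k : k ∈ ℤ }: the word z_{k₁}⋯z_{kₙ} is the list k₁ ∷ ⋯ ∷ kₙ.

Word : Set
Word = List ℤ

-- H = ℚ-span of words: finite formal ℚ-linear combinations, compared
-- via their coefficient functions (a setoid presentation of the free
-- ℚ-vector space on words).

Lin : Set
Lin = List (ℚ × Word)

coeff : Lin → Word → ℚ
coeff [] w = 0ℚ
coeff ((q , u) ∷ x) w with ≡-dec ℤ._≟_ u w
... | yes _ = q ℚ.+ coeff x w
... | no  _ = coeff x w

infix 4 _≈H_
_≈H_ : Lin → Lin → Set
x ≈H y = ∀ w → coeff x w ≡ coeff y w

word : Word → Lin
word w = (1ℚ , w) ∷ []

𝟙 : Lin
𝟙 = word []

scale : ℚ → Lin → Lin
scale q = map (λ { (p , w) → (q ℚ.* p , w) })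

negH : Lin → Lin
negH = scale (ℚ.- 1ℚ)

_-H_ : Lin → Lin → Lin
x -H y = x ++ negH y

consL : ℤ → Lin → Lin
consL k = map (λ { (q , w) → (q , k ∷ w) })

qsh : Word → Word → Lin
qsh [] v = word v
qsh (m ∷ u) [] = word (m ∷ u)
qsh (m ∷ u) (n ∷ v) =
  consL m (qsh u (n ∷ v)) ++ (consL n (qsh (m ∷ u) v) ++ consL (m ℤ.+ n) (qsh u v))

_∗_ : Lin → Lin → Lin
x ∗ y = concatMap (λ { (p , u) → concatMap (λ { (q , v) → scale (p ℚ.* q) (qsh u v) }) y }) x

Lin₂ : Set
Lin₂ = List (ℚ × Word × Word)

coeff₂ : Lin₂ → Word → Word → ℚ
coeff₂ [] a b = 0ℚ
coeff₂ ((q , u , v) ∷ t) a b with ≡-dec ℤ._≟_ u a | ≡-dec ℤ._≟_ v b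
... | yes _ | yes _ = q ℚ.+ coeff₂ t a b
... | _     | _     = coeff₂ t a b

infix 4 _≈₂_
_≈₂_ : Lin₂ → Lin₂ → Set
s ≈₂ t = ∀ a b → coeff₂ s a b ≡ coeff₂ t a b

_⊗_ : Lin → Lin → Lin₂
x ⊗ y = concatMap (λ { (p , u) → map (λ { (q , v) → (p ℚ.* q , u , v) }) y }) x

splits : Word → List (Word × Word)
splits [] = ([] , []) ∷ []
splits (a ∷ w) = ([] , a ∷ w) ∷ map (λ { (u , v) → (a ∷ u , v) }) (splits w)

properSplits : Word → List (Word × Word)
properSplits [] = []
properSplits (a ∷ w) = ([] , a ∷ w) ∷ map (λ { (u , v) → (a ∷ u , v) }) (properSplits w)

Δ : Lin → Lin₂
Δ = concatMap (λ { (q , w) → map (λ { (u , v) → (q , u , v) }) (splits w) })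

ε : Lin → ℚ
ε x = coeff x []

-- antipode (recursion S(w) = - Σ_{uv=w, v≠1} S(u) ∗ v, S(1) = 1),
-- with fuel = length of the word
Sfuel : ℕ → Word → Lin
Sfuel _ [] = 𝟙
Sfuel zero (_ ∷ _) = []
Sfuel (suc k) (a ∷ w) =
  negH (concatMap (λ { (u , v) → Sfuel k u ∗ word v }) (properSplits (a ∷ w)))

Sword : Word → Lin
Sword w = Sfuel (length w) w

S : Lin → Lin
S = concatMap (λ { (q , w) → scale q (Sword w) })

Bad₂ : ℤ → Set
Bad₂ s = s ≡ + 2 ⊎ (s ≡ + 1 ⊎ (s ℤ.≤ + 0 × (+ 2) ∣ s))

-- condition k₁+⋯+k_j ∉ ℤ_{≤ j} for j ≥ 3 (s = previous partial sum)
NSfrom : ℕ → ℤ → Word → Set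
NSfrom j s [] = ⊤
NSfrom j s (k ∷ w) = (+ j ℤ.< s ℤ.+ k) × NSfrom (suc j) (s ℤ.+ k) w

NS₂ : ℤ → Word → Set
NS₂ k₁ [] = ⊤
NS₂ k₁ (k₂ ∷ w) = ¬ Bad₂ (k₁ ℤ.+ k₂) × NSfrom 3 (k₁ ℤ.+ k₂) w

NonSingular : Word → Set
NonSingular [] = ⊥
NonSingular (k₁ ∷ w) = k₁ ≢ + 1 × NS₂ k₁ w

InN : Lin → Set
InN x = ∀ w → coeff x w ≢ 0ℚ → NonSingular w

data Inℐ : Lin → Set where
  gen  : ∀ {x} → InN x → Inℐ x
  add  : ∀ {x y} → Inℐ x → Inℐ y → Inℐ (x ++ y)
  smul : ∀ {x} (q : ℚ) → Inℐ x → Inℐ (scale q x)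
  mulL : ∀ {x} (a : Lin) → Inℐ x → Inℐ (a ∗ x)
  mulR : ∀ {x} (a : Lin) → Inℐ x → Inℐ (x ∗ a)
  resp : ∀ {x y} → x ≈H y → Inℐ x → Inℐ y

data InI⊗H+H⊗I (I : Lin → Set) : Lin₂ → Set where
  zero₂ : InI⊗H+H⊗I I []
  left  : ∀ {x} → I x → (y : Lin) → InI⊗H+H⊗I I (x ⊗ y)
  right : ∀ {y} → (x : Lin) → I y → InI⊗H+H⊗I I (x ⊗ y)
  add₂  : ∀ {s t} → InI⊗H+H⊗I I s → InI⊗H+H⊗I I t → InI⊗H+H⊗I I (s ++ t)
  resp₂ : ∀ {s t} → s ≈₂ t → InI⊗H+H⊗I I s → InI⊗H+H⊗I I t

record IsTwoSidedIdeal (I : Lin → Set) : Set where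
  field
    respects : ∀ {x y} → x ≈H y → I x → I y
    has-zero : I []
    closed-+ : ∀ {x y} → I x → I y → I (x ++ y)
    closed-· : ∀ {x} (q : ℚ) → I x → I (scale q x)
    closed-∗ˡ : ∀ {x} (a : Lin) → I x → I (a ∗ x)
    closed-∗ʳ : ∀ {x} (a : Lin) → I x → I (x ∗ a)

record IsHopfIdeal (I : Lin → Set) : Set where
  field
    isIdeal : IsTwoSidedIdeal I
    coideal-Δ : ∀ {x} → I x → InI⊗H+H⊗I I (Δ x)
    coideal-ε : ∀ {x} → I x → ε x ≡ 0ℚ
    antipode  : ∀ {x} → I x → I (S x)

record QAlgebra (c ℓ : Level) : Set (lsuc (c ⊔ ℓ)) where
  field
    commRing : CommutativeRing c ℓ
  open CommutativeRing commRing public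
  field
    ι : ℚ → Carrier
    ι-hom : RingMorphisms.IsRingHomomorphism
              (CommutativeRing.rawRing +-*-commutativeRing) rawRing ι

module _ {c ℓ : Level} (A : QAlgebra c ℓ) where
  open QAlgebra A

  ext : (Word → Carrier) → Lin → Carrier
  ext φ = foldr (λ { (q , w) acc → ι q * φ w + acc }) 0#

  -- φ ∈ G_A : unital algebra morphism (H, ∗) → A (given on the word basis)
  IsCharH : (Word → Carrier) → Set ℓ
  IsCharH φ = (φ [] ≈ 1#) × (∀ u v → ext φ (qsh u v) ≈ φ u * φ v)

  IsTransfer : (Word → Carrier) → Set ℓ
  IsTransfer φ = IsCharH φ × (∀ w → NonSingular w → φ w ≈ 0#)

  conv : (Word → Carrier) → (Word → Carrier) → (Word → Carrier)
  conv φ ψ w = foldr (λ { (u , v) acc → φ u * ψ v + acc }) 0# (splits w)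

  -- characters of H/𝒩 (setoid quotient: maps on H constant on classes
  -- x ~ y ⇔ x - y ∈ 𝒩), i.e. unital algebra morphisms H/𝒩 → A
  record IsQuotChar (χ : Lin → Carrier) : Set ℓ where
    field
      well-defined : ∀ x y → Inℐ (x -H y) → χ x ≈ χ y
      additive     : ∀ x y → χ (x ++ y) ≈ χ x + χ y
      homogeneous  : ∀ q x → χ (scale q x) ≈ ι q * χ x
      unital       : χ 𝟙 ≈ 1#
      multiplicative : ∀ x y → χ (x ∗ y) ≈ χ x * χ y

  convQ : (Lin → Carrier) → (Lin → Carrier) → (Lin → Carrier)
  convQ χ ψ x = foldr (λ { (q , u , v) acc → ι q * (χ (word u) * ψ (word v)) + acc }) 0# (Δ x)

  TA : Set (c ⊔ ℓ)
  TA = Σ (Word → Carrier) IsTransfer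

  CharQ : Set (c ⊔ ℓ)
  CharQ = Σ (Lin → Carrier) IsQuotChar

  _≐T_ : TA → TA → Set ℓ
  (φ , _) ≐T (ψ , _) = ∀ w → φ w ≈ ψ w

  _≐C_ : CharQ → CharQ → Set ℓ
  (χ , _) ≐C (ψ , _) = ∀ x → χ x ≈ ψ x

  -- T_A ≅ Char(H/𝒩) as groups: both are closed under their convolution
  -- products, and there is a bijection (up to pointwise equality)
  -- preserving the products.
  record TransferIso : Set (c ⊔ ℓ) where
    field
      T-closed : ∀ φ ψ → IsTransfer φ → IsTransfer ψ → IsTransfer (conv φ ψ)
      C-closed : ∀ χ ψ → IsQuotChar χ → IsQuotChar ψ → IsQuotChar (convQ χ ψ)
      to   : TA → CharQ
      from : CharQ → TA
      to-cong   : ∀ a b → a ≐T b → to a ≐C to b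
      from-cong : ∀ a b → a ≐C b → from a ≐T from b
      from-to : ∀ a → from (to a) ≐T a
      to-from : ∀ b → to (from b) ≐C b
      to-hom : ∀ φ ψ (p : IsTransfer φ) (q : IsTransfer ψ) →
               to (conv φ ψ , T-closed φ ψ p q)
                 ≐C (convQ (Σ.proj₁ (to (φ , p))) (Σ.proj₁ (to (ψ , q))) ,
                     C-closed _ _ (Σ.proj₂ (to (φ , p))) (Σ.proj₂ (to (ψ , q))))

-- Everything is proved by duality. A formal ℚ-combination x of words is determined
-- by its pairings ⟦ x ⟧ f = Σ q f(w) with all maps f from words to ℚ, and the
-- quasi-shuffle product, the deconcatenation coproduct and the antipode have
-- transposes acting on such maps. The Hopf algebra identities
-- in H, namely commutativity, Δ (x ∗ y) = Δ x ∗ Δ y and S (x ∗ y) = S x ∗ S y,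
-- thereby become identities between finite sums in a commutative ring, proved by
-- induction on words.
--
-- Non-singularity passes to nonempty prefixes, so Δ maps a non-singular word into
-- N ⊗ H + H ⊗ N, and the recursion for S maps it into 𝒩. As H is commutative, Δ and
-- S then carry the whole ideal 𝒩 into 𝒩 ⊗ H + H ⊗ 𝒩 and 𝒩; ε vanishes on 𝒩 because
-- the counit is itself a transfer character.
--
-- A character of H vanishing on N vanishes on 𝒩, so restriction to words and linear
-- extension are mutually inverse bijections between T_A and the characters of H/𝒩,
-- and both convolutions are computed from the same coproduct.

module Submission where

open import Defs
open import Level using (Level; _⊔_; 0ℓ)
open import Data.Nat as ℕ using (suc; _≤_; _<_; z≤n; s≤s)
import Data.Nat.Properties as ℕP
open import Data.Integer as ℤ using (ℤ)
import Data.Integer.Properties as ℤP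
open import Data.Rational as ℚ using (ℚ; 0ℚ; 1ℚ)
import Data.Rational.Properties as ℚP
open import Data.List using (List; []; _∷_; _++_; map; concatMap; concat; foldr; length; filter)
open import Data.List.Properties using (≡-dec; map-∘)
import Data.Product.Properties as ×P
open import Data.List.Relation.Unary.All as All using (All; []; _∷_)
import Data.List.Relation.Unary.All.Properties as AllP
open import Data.Product using (_×_; _,_; proj₁; proj₂)
open import Data.Unit using (tt)
open import Data.Maybe using (nothing)
open import Relation.Nullary using (¬_; ¬?; yes; no; Dec; contradiction)
open import Relation.Binary.Definitions using (DecidableEquality)
open import Relation.Binary.PropositionalEquality as ≡ using (_≡_; _≢_)
open import Algebra.Morphism.Structures using (module RingMorphisms)
open import Tactic.RingSolver.Core.AlmostCommutativeRing using (fromCommutativeRing)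
import Tactic.RingSolver.NonReflective as NonReflective

-- Finite sums and linear functionals

module LinearAlgebra {c ℓ : Level} (A : QAlgebra c ℓ) where
  open QAlgebra A public
  open RingMorphisms.IsRingHomomorphism ι-hom public using ()
    renaming (+-homo to ι-+; *-homo to ι-*; 0#-homo to ι-0; 1#-homo to ι-1; -‿homo to ι-neg; ⟦⟧-cong to ι-cong)
  open import Algebra.Properties.Ring ring public using (-1*x≈-x)
  open import Algebra.Properties.AbelianGroup +-abelianGroup public using ()
    renaming (∙-cancelʳ to +-cancelʳ; identityʳ-unique to +-identityʳ-unique; x∙y⁻¹≈ε⇒x≈y to x-y≈0⇒x≈y)
  open import Algebra.Properties.CommutativeSemigroup +-commutativeSemigroup public using ()
    renaming (interchange to +-interchange; x∙yz≈y∙xz to x+yz≈y+xz)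
  open import Algebra.Properties.CommutativeSemigroup *-commutativeSemigroup public using ()
    renaming (interchange to *-interchange; x∙yz≈y∙xz to x*yz≈y*xz)
  open import Relation.Binary.Reasoning.Setoid setoid public
  open NonReflective (fromCommutativeRing commRing (λ _ → nothing)) public
    using (solve; _⊜_; _⊕_) renaming (_⊗_ to _⊠_)

  ∑ : {X : Set} → List X → (X → Carrier) → Carrier
  ∑ []       f = 0#
  ∑ (x ∷ xs) f = f x + ∑ xs f

  foldr-as-∑ : ∀ {X : Set} (h : X → Carrier) xs → foldr (λ x acc → h x + acc) 0# xs ≡ ∑ xs h
  foldr-as-∑ h []       = ≡.refl
  foldr-as-∑ h (x ∷ xs) = ≡.cong (h x +_) (foldr-as-∑ h xs)

  ∑-cong : ∀ {X : Set} (xs : List X) {f g : X → Carrier} → (∀ x → f x ≈ g x) → ∑ xs f ≈ ∑ xs g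
  ∑-cong []       f≈g = refl
  ∑-cong (x ∷ xs) f≈g = +-cong (f≈g x) (∑-cong xs f≈g)

  ∑-*ˡ : ∀ {X : Set} (xs : List X) r (f : X → Carrier) → ∑ xs (λ x → r * f x) ≈ r * ∑ xs f
  ∑-*ˡ []       r f = sym (zeroʳ r)
  ∑-*ˡ (x ∷ xs) r f = trans (+-cong refl (∑-*ˡ xs r f)) (sym (distribˡ r (f x) (∑ xs f)))

  ∑-map : ∀ {X Y : Set} (h : X → Y) (xs : List X) (f : Y → Carrier) → ∑ (map h xs) f ≡ ∑ xs (λ x → f (h x))
  ∑-map h []       f = ≡.refl
  ∑-map h (x ∷ xs) f = ≡.cong (f (h x) +_) (∑-map h xs f)

  record IsLinear {K : Set} (L : (K → Carrier) → Carrier) : Set (c ⊔ ℓ) where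
    field
      lin-cong : ∀ {f g} → (∀ k → f k ≈ g k) → L f ≈ L g
      lin-+    : ∀ f g → L (λ k → f k + g k) ≈ L f + L g
      lin-*    : ∀ r f → L (λ k → r * f k) ≈ r * L f

    lin-0 : L (λ _ → 0#) ≈ 0#
    lin-0 = begin
      L (λ _ → 0#)       ≈⟨ lin-cong (λ _ → sym (zeroˡ 0#)) ⟩
      L (λ _ → 0# * 0#)  ≈⟨ lin-* 0# (λ _ → 0#) ⟩
      0# * L (λ _ → 0#)  ≈⟨ zeroˡ _ ⟩
      0#                 ∎

    lin-*ʳ : ∀ r f → L (λ k → f k * r) ≈ L f * r
    lin-*ʳ r f = trans (lin-cong (λ k → *-comm (f k) r)) (trans (lin-* r f) (*-comm r _))

    lin-vanish : ∀ {f} → (∀ k → f k ≈ 0#) → L f ≈ 0#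
    lin-vanish f≈0 = trans (lin-cong f≈0) lin-0
  open IsLinear public

  ∘-isLinear : ∀ {K K′ : Set} {L : (K → Carrier) → Carrier} {M : K → (K′ → Carrier) → Carrier} →
               IsLinear L → (∀ k → IsLinear (M k)) → IsLinear (λ g → L (λ k → M k g))
  ∘-isLinear L-lin M-lin = record
    { lin-cong = λ f≈g → lin-cong L-lin (λ k → lin-cong (M-lin k) f≈g)
    ; lin-+    = λ f g → trans (lin-cong L-lin (λ k → lin-+ (M-lin k) f g)) (lin-+ L-lin _ _)
    ; lin-*    = λ r f → trans (lin-cong L-lin (λ k → lin-* (M-lin k) r f)) (lin-* L-lin r _)
    }

  module Combination {K : Set} (_≟ₖ_ : DecidableEquality K) where

    Comb : Set
    Comb = List (ℚ × K)

    coefficient : Comb → K → ℚ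
    coefficient []            k = 0ℚ
    coefficient ((q , u) ∷ x) k with u ≟ₖ k
    ... | yes _ = q ℚ.+ coefficient x k
    ... | no  _ = coefficient x k

    infix 20 ⟦_⟧_
    ⟦_⟧_ : Comb → (K → Carrier) → Carrier
    ⟦ []          ⟧ f = 0#
    ⟦ (q , u) ∷ x ⟧ f = ι q * f u + ⟦ x ⟧ f

    ⟦⟧-as-∑ : ∀ x f → ⟦ x ⟧ f ≡ ∑ x (λ (q , k) → ι q * f k)
    ⟦⟧-as-∑ []            f = ≡.refl
    ⟦⟧-as-∑ ((q , u) ∷ x) f = ≡.cong (ι q * f u +_) (⟦⟧-as-∑ x f)

    ⟦⟧-cong : ∀ x {f g} → (∀ k → f k ≈ g k) → ⟦ x ⟧ f ≈ ⟦ x ⟧ g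
    ⟦⟧-cong []            f≈g = refl
    ⟦⟧-cong ((q , u) ∷ x) f≈g = +-cong (*-congˡ (f≈g u)) (⟦⟧-cong x f≈g)

    ⟦⟧-isLinear : ∀ x → IsLinear (⟦ x ⟧_)
    ⟦⟧-isLinear x = record { lin-cong = ⟦⟧-cong x ; lin-+ = additive x ; lin-* = homogeneous x }
      where
      additive : ∀ x f g → ⟦ x ⟧ (λ k → f k + g k) ≈ ⟦ x ⟧ f + ⟦ x ⟧ g
      additive []            f g = sym (+-identityʳ 0#)
      additive ((q , u) ∷ x) f g =
        trans (+-cong (distribˡ (ι q) (f u) (g u)) (additive x f g)) (+-interchange _ _ _ _)
      homogeneous : ∀ x r f → ⟦ x ⟧ (λ k → r * f k) ≈ r * ⟦ x ⟧ f
      homogeneous []            r f = sym (zeroʳ r)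
      homogeneous ((q , u) ∷ x) r f =
        trans (+-cong (x*yz≈y*xz (ι q) r (f u)) (homogeneous x r f))
              (sym (distribˡ r _ _))

    ⟦⟧-++ : ∀ x y f → ⟦ x ++ y ⟧ f ≈ ⟦ x ⟧ f + ⟦ y ⟧ f
    ⟦⟧-++ []            y f = sym (+-identityˡ _)
    ⟦⟧-++ ((q , u) ∷ x) y f = trans (+-cong refl (⟦⟧-++ x y f)) (sym (+-assoc _ _ _))

    ⟦⟧-concatMap : ∀ {X : Set} (g : X → Comb) xs f → ⟦ concatMap g xs ⟧ f ≈ ∑ xs (λ x → ⟦ g x ⟧ f)
    ⟦⟧-concatMap g []       f = refl
    ⟦⟧-concatMap g (x ∷ xs) f = trans (⟦⟧-++ (g x) (concatMap g xs) f) (+-cong refl (⟦⟧-concatMap g xs f))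

    ⟦⟧-comm : ∀ {K′ : Set} x {L : (K′ → Carrier) → Carrier} → IsLinear L → (f : K → K′ → Carrier) →
              ⟦ x ⟧ (λ k → L (f k)) ≈ L (λ k′ → ⟦ x ⟧ (λ k → f k k′))
    ⟦⟧-comm []            L-lin f = sym (lin-0 L-lin)
    ⟦⟧-comm ((q , u) ∷ x) L-lin f =
      trans (+-cong (sym (lin-* L-lin (ι q) (f u))) (⟦⟧-comm x L-lin f)) (sym (lin-+ L-lin _ _))

    removeKey : K → Comb → Comb
    removeKey k []            = []
    removeKey k ((q , u) ∷ x) with u ≟ₖ k
    ... | yes _ = removeKey k x
    ... | no  _ = (q , u) ∷ removeKey k x

    length-removeKey : ∀ k x → length (removeKey k x) ≤ length x
    length-removeKey k []            = z≤n
    length-removeKey k ((q , u) ∷ x) with u ≟ₖ k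
    ... | yes _ = ℕP.m≤n⇒m≤1+n (length-removeKey k x)
    ... | no  _ = s≤s (length-removeKey k x)

    length-removeKey-head : ∀ q u x → length (removeKey u ((q , u) ∷ x)) ≤ length x
    length-removeKey-head q u x with u ≟ₖ u
    ... | yes _   = length-removeKey u x
    ... | no  u≢u = contradiction ≡.refl u≢u

    coefficient-removeKey : ∀ k x → coefficient (removeKey k x) k ≡ 0ℚ
    coefficient-removeKey k []            = ≡.refl
    coefficient-removeKey k ((q , u) ∷ x) with u ≟ₖ k
    ... | yes _   = coefficient-removeKey k x
    ... | no  u≢k with u ≟ₖ k
    ...   | yes u≡k = contradiction u≡k u≢k
    ...   | no  _   = coefficient-removeKey k x

    coefficient-removeKey-≢ : ∀ k k′ x → k′ ≢ k → coefficient (removeKey k x) k′ ≡ coefficient x k′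
    coefficient-removeKey-≢ k k′ []            k′≢k = ≡.refl
    coefficient-removeKey-≢ k k′ ((q , u) ∷ x) k′≢k with u ≟ₖ k
    coefficient-removeKey-≢ k k′ ((q , u) ∷ x) k′≢k | yes ≡.refl with u ≟ₖ k′
    ... | yes ≡.refl = contradiction ≡.refl k′≢k
    ... | no  _      = coefficient-removeKey-≢ k k′ x k′≢k
    coefficient-removeKey-≢ k k′ ((q , u) ∷ x) k′≢k | no _ with u ≟ₖ k′
    ... | yes _ = ≡.cong (q ℚ.+_) (coefficient-removeKey-≢ k k′ x k′≢k)
    ... | no  _ = coefficient-removeKey-≢ k k′ x k′≢k

    ⟦⟧-removeKey : ∀ k x f → ⟦ x ⟧ f ≈ ι (coefficient x k) * f k + ⟦ removeKey k x ⟧ f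
    ⟦⟧-removeKey k []            f = sym (trans (+-identityʳ _) (trans (*-congʳ ι-0) (zeroˡ _)))
    ⟦⟧-removeKey k ((q , u) ∷ x) f with u ≟ₖ k
    ... | yes ≡.refl = begin
      ι q * f u + ⟦ x ⟧ f
        ≈⟨ +-cong refl (⟦⟧-removeKey u x f) ⟩
      ι q * f u + (ι (coefficient x u) * f u + ⟦ removeKey u x ⟧ f)
        ≈⟨ trans (sym (+-assoc _ _ _)) (+-cong (sym (distribʳ (f u) (ι q) _)) refl) ⟩
      (ι q + ι (coefficient x u)) * f u + ⟦ removeKey u x ⟧ f
        ≈⟨ +-cong (*-congʳ (sym (ι-+ q _))) refl ⟩
      ι (q ℚ.+ coefficient x u) * f u + ⟦ removeKey u x ⟧ f ∎
    ... | no _ = trans (+-cong refl (⟦⟧-removeKey k x f)) (x+yz≈y+xz _ _ _)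

    coefficients-removeKey : ∀ u x y → (∀ k → coefficient x k ≡ coefficient y k) →
                             ∀ k → coefficient (removeKey u x) k ≡ coefficient (removeKey u y) k
    coefficients-removeKey u x y x≗y k with k ≟ₖ u
    ... | yes ≡.refl = ≡.trans (coefficient-removeKey k x) (≡.sym (coefficient-removeKey k y))
    ... | no  k≢u    = ≡.trans (coefficient-removeKey-≢ u k x k≢u)
                         (≡.trans (x≗y k) (≡.sym (coefficient-removeKey-≢ u k y k≢u)))

    -- Induction on length x: removing all terms with the key of the head shortens x.
    ⟦⟧-resp-coefficient : ∀ x y f → (∀ k → coefficient x k ≡ coefficient y k) → ⟦ x ⟧ f ≈ ⟦ y ⟧ f
    ⟦⟧-resp-coefficient x y f = go (length x) x y ℕP.≤-refl
      where
      vanishing : ∀ n y → length y ≤ n → (∀ k → 0ℚ ≡ coefficient y k) → 0# ≈ ⟦ y ⟧ f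
      vanishing n       []            _         _   = refl
      vanishing (suc n) ((q , u) ∷ y) (s≤s len) y≗0 = sym (begin
        ⟦ (q , u) ∷ y ⟧ f
          ≈⟨ ⟦⟧-removeKey u ((q , u) ∷ y) f ⟩
        ι (coefficient ((q , u) ∷ y) u) * f u + ⟦ removeKey u ((q , u) ∷ y) ⟧ f
          ≈⟨ +-cong (trans (*-congʳ (trans (ι-cong (≡.sym (y≗0 u))) ι-0)) (zeroˡ _))
                    (sym (vanishing n (removeKey u ((q , u) ∷ y)) (ℕP.≤-trans (length-removeKey-head q u y) len)
                                        (coefficients-removeKey u [] ((q , u) ∷ y) y≗0))) ⟩
        0# + 0#
          ≈⟨ +-identityʳ 0# ⟩
        0# ∎)
      go : ∀ n x y → length x ≤ n → (∀ k → coefficient x k ≡ coefficient y k) → ⟦ x ⟧ f ≈ ⟦ y ⟧ f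
      go n       []            y _         x≗y = vanishing (length y) y ℕP.≤-refl x≗y
      go (suc n) ((q , u) ∷ x) y (s≤s len) x≗y = begin
        ⟦ (q , u) ∷ x ⟧ f
          ≈⟨ ⟦⟧-removeKey u ((q , u) ∷ x) f ⟩
        ι (coefficient ((q , u) ∷ x) u) * f u + ⟦ removeKey u ((q , u) ∷ x) ⟧ f
          ≈⟨ +-cong (*-congʳ (ι-cong (x≗y u)))
                    (go n (removeKey u ((q , u) ∷ x)) (removeKey u y) (ℕP.≤-trans (length-removeKey-head q u x) len)
                        (coefficients-removeKey u ((q , u) ∷ x) y x≗y)) ⟩
        ι (coefficient y u) * f u + ⟦ removeKey u y ⟧ f
          ≈⟨ ⟦⟧-removeKey u y f ⟨
        ⟦ y ⟧ f ∎

map-cong-properSplits : ∀ {B : Set} w (f g : Word × Word → B) →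
                        (∀ x y → length x < length w → f (x , y) ≡ g (x , y)) →
                        map f (properSplits w) ≡ map g (properSplits w)
map-cong-properSplits []      f g f≡g = ≡.refl
map-cong-properSplits (a ∷ w) f g f≡g = ≡.cong₂ _∷_ (f≡g [] (a ∷ w) (s≤s z≤n)) (begin
  map f (map (λ (u , v) → (a ∷ u , v)) (properSplits w))  ≡⟨ map-∘ (properSplits w) ⟨
  map (λ (u , v) → f (a ∷ u , v)) (properSplits w)      ≡⟨ map-cong-properSplits w _ _ (λ x y lt → f≡g (a ∷ x) y (s≤s lt)) ⟩
  map (λ (u , v) → g (a ∷ u , v)) (properSplits w)      ≡⟨ map-∘ (properSplits w) ⟩
  map g (map (λ (u , v) → (a ∷ u , v)) (properSplits w))  ∎)
  where open ≡.≡-Reasoning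

Sfuel-stable : ∀ {k j} u → length u ≤ k → length u ≤ j → Sfuel k u ≡ Sfuel j u
Sfuel-stable []      _         _         = ≡.refl
Sfuel-stable {suc k} {suc j} (a ∷ w) (s≤s w≤k) (s≤s w≤j) =
  ≡.cong negH (≡.cong concat (map-cong-properSplits (a ∷ w) _ _ λ x y x<aw →
    ≡.cong (_∗ word y) (Sfuel-stable x (ℕP.≤-trans (ℕP.≤-pred x<aw) w≤k) (ℕP.≤-trans (ℕP.≤-pred x<aw) w≤j))))

infixl 7 _∗₂_
_∗₂_ : Lin₂ → Lin₂ → Lin₂
s ∗₂ t = concatMap (λ (p , a , b) → concatMap (λ (q , c , d) → scale (p ℚ.* q) (qsh a c) ⊗ qsh b d) t) s

-- The structure maps of H, transposed

module Pairing {c ℓ : Level} (A : QAlgebra c ℓ) where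
  open LinearAlgebra A public

  open Combination (≡-dec ℤ._≟_) public

  coefficient≡coeff : ∀ x w → coefficient x w ≡ coeff x w
  coefficient≡coeff []            w = ≡.refl
  coefficient≡coeff ((q , u) ∷ x) w with ≡-dec ℤ._≟_ u w
  ... | yes _ = ≡.cong (q ℚ.+_) (coefficient≡coeff x w)
  ... | no  _ = coefficient≡coeff x w

  ⟦⟧-resp-≈H : ∀ {x y} → x ≈H y → ∀ f → ⟦ x ⟧ f ≈ ⟦ y ⟧ f
  ⟦⟧-resp-≈H {x} {y} x≈y f = ⟦⟧-resp-coefficient x y f λ w →
    ≡.trans (coefficient≡coeff x w) (≡.trans (x≈y w) (≡.sym (coefficient≡coeff y w)))

  ext≡⟦⟧ : ∀ φ x → ext A φ x ≡ ⟦ x ⟧ φ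
  ext≡⟦⟧ φ []            = ≡.refl
  ext≡⟦⟧ φ ((q , w) ∷ x) = ≡.cong (ι q * φ w +_) (ext≡⟦⟧ φ x)

  ⟦word⟧ : ∀ w f → ⟦ word w ⟧ f ≈ f w
  ⟦word⟧ w f = trans (+-identityʳ _) (trans (*-congʳ ι-1) (*-identityˡ _))

  ⟦scale⟧ : ∀ q x f → ⟦ scale q x ⟧ f ≈ ι q * ⟦ x ⟧ f
  ⟦scale⟧ q []            f = sym (zeroʳ _)
  ⟦scale⟧ q ((p , w) ∷ x) f =
    trans (+-cong (trans (*-congʳ (ι-* q p)) (*-assoc _ _ _)) (⟦scale⟧ q x f)) (sym (distribˡ _ _ _))

  ⟦negH⟧ : ∀ x f → ⟦ negH x ⟧ f ≈ - ⟦ x ⟧ f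
  ⟦negH⟧ x f = trans (⟦scale⟧ _ x f) (trans (*-congʳ (trans (ι-neg 1ℚ) (-‿cong ι-1))) (-1*x≈-x _))

  ⟦consL⟧ : ∀ k x f → ⟦ consL k x ⟧ f ≡ ⟦ x ⟧ (λ t → f (k ∷ t))
  ⟦consL⟧ k []            f = ≡.refl
  ⟦consL⟧ k ((q , w) ∷ x) f = ≡.cong (ι q * f (k ∷ w) +_) (⟦consL⟧ k x f)

  -- ᵗ marks a transpose: qshᵗ u v f = ⟦ qsh u v ⟧ f and Sᵗ u f = ⟦ Sword u ⟧ f.
  qshᵗ : Word → Word → (Word → Carrier) → Carrier
  qshᵗ []      v       f = f v
  qshᵗ (m ∷ u) []      f = f (m ∷ u)
  qshᵗ (m ∷ u) (n ∷ v) f =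
    qshᵗ u (n ∷ v) (λ t → f (m ∷ t)) + (qshᵗ (m ∷ u) v (λ t → f (n ∷ t)) + qshᵗ u v (λ t → f (m ℤ.+ n ∷ t)))

  qshᵗ-[]ʳ : ∀ u f → qshᵗ u [] f ≡ f u
  qshᵗ-[]ʳ []      f = ≡.refl
  qshᵗ-[]ʳ (m ∷ u) f = ≡.refl

  ⟦qsh⟧ : ∀ u v f → ⟦ qsh u v ⟧ f ≈ qshᵗ u v f
  ⟦qsh⟧ []      v       f = ⟦word⟧ v f
  ⟦qsh⟧ (m ∷ u) []      f = ⟦word⟧ (m ∷ u) f
  ⟦qsh⟧ (m ∷ u) (n ∷ v) f = begin
    ⟦ consL m (qsh u (n ∷ v)) ++ (consL n (qsh (m ∷ u) v) ++ consL (m ℤ.+ n) (qsh u v)) ⟧ f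
      ≈⟨ trans (⟦⟧-++ (consL m (qsh u (n ∷ v))) _ f) (+-cong refl (⟦⟧-++ (consL n (qsh (m ∷ u) v)) _ f)) ⟩
    ⟦ consL m (qsh u (n ∷ v)) ⟧ f + (⟦ consL n (qsh (m ∷ u) v) ⟧ f + ⟦ consL (m ℤ.+ n) (qsh u v) ⟧ f)
      ≡⟨ ≡.cong₂ _+_ (⟦consL⟧ m (qsh u (n ∷ v)) f)
                     (≡.cong₂ _+_ (⟦consL⟧ n (qsh (m ∷ u) v) f) (⟦consL⟧ (m ℤ.+ n) (qsh u v) f)) ⟩
    ⟦ qsh u (n ∷ v) ⟧ (λ t → f (m ∷ t)) + (⟦ qsh (m ∷ u) v ⟧ (λ t → f (n ∷ t)) + ⟦ qsh u v ⟧ (λ t → f (m ℤ.+ n ∷ t)))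
      ≈⟨ +-cong (⟦qsh⟧ u (n ∷ v) _) (+-cong (⟦qsh⟧ (m ∷ u) v _) (⟦qsh⟧ u v _)) ⟩
    qshᵗ (m ∷ u) (n ∷ v) f ∎

  ⟦∗⟧ : ∀ x y f → ⟦ x ∗ y ⟧ f ≈ ⟦ x ⟧ (λ u → ⟦ y ⟧ (λ v → qshᵗ u v f))
  ⟦∗⟧ x y f = begin
    ⟦ x ∗ y ⟧ f
      ≈⟨ ⟦⟧-concatMap _ x f ⟩
    ∑ x (λ (p , u) → ⟦ concatMap (λ (q , v) → scale (p ℚ.* q) (qsh u v)) y ⟧ f)
      ≈⟨ ∑-cong x (λ (p , u) → trans (⟦⟧-concatMap _ y f) (inner p u)) ⟩
    ∑ x (λ (p , u) → ι p * ⟦ y ⟧ (λ v → qshᵗ u v f))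
      ≡⟨ ⟦⟧-as-∑ x _ ⟨
    ⟦ x ⟧ (λ u → ⟦ y ⟧ (λ v → qshᵗ u v f)) ∎
    where
    inner : ∀ p u → ∑ y (λ (q , v) → ⟦ scale (p ℚ.* q) (qsh u v) ⟧ f) ≈ ι p * ⟦ y ⟧ (λ v → qshᵗ u v f)
    inner p u = begin
      ∑ y (λ (q , v) → ⟦ scale (p ℚ.* q) (qsh u v) ⟧ f)
        ≈⟨ ∑-cong y (λ (q , v) → trans (⟦scale⟧ (p ℚ.* q) (qsh u v) f)
                                   (trans (*-cong (ι-* p q) (⟦qsh⟧ u v f)) (*-assoc _ _ _))) ⟩
      ∑ y (λ (q , v) → ι p * (ι q * qshᵗ u v f))
        ≈⟨ ∑-*ˡ y (ι p) _ ⟩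
      ι p * ∑ y (λ (q , v) → ι q * qshᵗ u v f)
        ≡⟨ ≡.cong (ι p *_) (⟦⟧-as-∑ y _) ⟨
      ι p * ⟦ y ⟧ (λ v → qshᵗ u v f) ∎

  qshᵗ-cong : ∀ u v {f g} → (∀ t → f t ≈ g t) → qshᵗ u v f ≈ qshᵗ u v g
  qshᵗ-cong []      v       f≈g = f≈g v
  qshᵗ-cong (m ∷ u) []      f≈g = f≈g (m ∷ u)
  qshᵗ-cong (m ∷ u) (n ∷ v) f≈g =
    +-cong (qshᵗ-cong u (n ∷ v) (λ t → f≈g (m ∷ t)))
           (+-cong (qshᵗ-cong (m ∷ u) v (λ t → f≈g (n ∷ t))) (qshᵗ-cong u v (λ t → f≈g (m ℤ.+ n ∷ t))))

  qshᵗ-isLinear : ∀ u v → IsLinear (qshᵗ u v)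
  qshᵗ-isLinear u v = record { lin-cong = qshᵗ-cong u v ; lin-+ = additive u v ; lin-* = homogeneous u v }
    where
    additive : ∀ u v f g → qshᵗ u v (λ t → f t + g t) ≈ qshᵗ u v f + qshᵗ u v g
    additive []      v       f g = refl
    additive (m ∷ u) []      f g = refl
    additive (m ∷ u) (n ∷ v) f g =
      trans (+-cong (additive u (n ∷ v) _ _) (+-cong (additive (m ∷ u) v _ _) (additive u v _ _)))
            (trans (+-cong refl (+-interchange _ _ _ _)) (+-interchange _ _ _ _))
    homogeneous : ∀ u v r f → qshᵗ u v (λ t → r * f t) ≈ r * qshᵗ u v f
    homogeneous []      v       r f = refl
    homogeneous (m ∷ u) []      r f = refl
    homogeneous (m ∷ u) (n ∷ v) r f =
      trans (+-cong (homogeneous u (n ∷ v) r _) (+-cong (homogeneous (m ∷ u) v r _) (homogeneous u v r _)))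
            (sym (trans (distribˡ r _ _) (+-cong refl (distribˡ r _ _))))

  qshᵗ-+₃ : ∀ u v f g h → qshᵗ u v (λ t → f t + (g t + h t)) ≈ qshᵗ u v f + (qshᵗ u v g + qshᵗ u v h)
  qshᵗ-+₃ u v f g h = trans (lin-+ (qshᵗ-isLinear u v) f _) (+-cong refl (lin-+ (qshᵗ-isLinear u v) g h))

  qshᵗ-comm : ∀ u v f → qshᵗ u v f ≈ qshᵗ v u f
  qshᵗ-comm []      []      f = refl
  qshᵗ-comm []      (n ∷ v) f = refl
  qshᵗ-comm (m ∷ u) []      f = refl
  qshᵗ-comm (m ∷ u) (n ∷ v) f = begin
    qshᵗ u (n ∷ v) (λ t → f (m ∷ t)) + (qshᵗ (m ∷ u) v (λ t → f (n ∷ t)) + qshᵗ u v (λ t → f (m ℤ.+ n ∷ t)))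
      ≈⟨ +-cong (qshᵗ-comm u (n ∷ v) _) (+-cong (qshᵗ-comm (m ∷ u) v _) (qshᵗ-comm u v _)) ⟩
    qshᵗ (n ∷ v) u (λ t → f (m ∷ t)) + (qshᵗ v (m ∷ u) (λ t → f (n ∷ t)) + qshᵗ v u (λ t → f (m ℤ.+ n ∷ t)))
      ≈⟨ +-cong refl (+-cong refl (qshᵗ-cong v u (λ t → reflexive (≡.cong (λ k → f (k ∷ t)) (ℤP.+-comm m n))))) ⟩
    qshᵗ (n ∷ v) u (λ t → f (m ∷ t)) + (qshᵗ v (m ∷ u) (λ t → f (n ∷ t)) + qshᵗ v u (λ t → f (n ℤ.+ m ∷ t)))
      ≈⟨ x+yz≈y+xz _ _ _ ⟩
    qshᵗ v (m ∷ u) (λ t → f (n ∷ t)) + (qshᵗ (n ∷ v) u (λ t → f (m ∷ t)) + qshᵗ v u (λ t → f (n ℤ.+ m ∷ t))) ∎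

  -- (a ∗ b) ∗ c and a ∗ (b ∗ c), paired with f
  qshᵗ₃ˡ qshᵗ₃ʳ : Word → Word → Word → (Word → Carrier) → Carrier
  qshᵗ₃ˡ a b c f = qshᵗ a b (λ t → qshᵗ t c f)
  qshᵗ₃ʳ a b c f = qshᵗ b c (λ t → qshᵗ a t f)

  -- The seven ways the first letters z_m, z_n, z_p of the three factors can
  -- contribute the first letter of a term of a triple quasi-shuffle product.
  firstLetterSum : (Word → Word → Word → (Word → Carrier) → Carrier) →
                   ℤ → Word → ℤ → Word → ℤ → Word → (Word → Carrier) → Carrier
  firstLetterSum T m u n v p w f =
    T u (n ∷ v) (p ∷ w) (shift m) + (T (m ∷ u) v (p ∷ w) (shift n) + (T (m ∷ u) (n ∷ v) w (shift p) +
    (T u v (p ∷ w) (shift (m ℤ.+ n)) + (T u (n ∷ v) w (shift (m ℤ.+ p)) + (T (m ∷ u) v w (shift (n ℤ.+ p)) +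
     T u v w (shift (m ℤ.+ n ℤ.+ p)))))))
    where
    shift : ℤ → Word → Carrier
    shift k t = f (k ∷ t)

  qshᵗ₃ˡ-firstLetter : ∀ m u n v p w f →
    qshᵗ₃ˡ (m ∷ u) (n ∷ v) (p ∷ w) f ≈ firstLetterSum qshᵗ₃ˡ m u n v p w f
  qshᵗ₃ˡ-firstLetter m u n v p w f =
    trans (+-cong (qshᵗ-+₃ u (n ∷ v) _ _ _) (+-cong (qshᵗ-+₃ (m ∷ u) v _ _ _) (qshᵗ-+₃ u v _ _ _)))
          (solve 9 (λ a₁ b₁ c₁ a₂ b₂ c₂ a₃ b₃ c₃ →
                      ((a₁ ⊕ (b₁ ⊕ c₁)) ⊕ ((a₂ ⊕ (b₂ ⊕ c₂)) ⊕ (a₃ ⊕ (b₃ ⊕ c₃)))) ⊜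
                      (a₁ ⊕ (a₂ ⊕ ((b₁ ⊕ (b₂ ⊕ b₃)) ⊕ (a₃ ⊕ (c₁ ⊕ (c₂ ⊕ c₃)))))))
                   refl _ _ _ _ _ _ _ _ _)

  qshᵗ₃ʳ-firstLetter : ∀ m u n v p w f →
    qshᵗ₃ʳ (m ∷ u) (n ∷ v) (p ∷ w) f ≈ firstLetterSum qshᵗ₃ʳ m u n v p w f
  qshᵗ₃ʳ-firstLetter m u n v p w f =
    trans (+-cong (qshᵗ-+₃ v (p ∷ w) _ _ _) (+-cong (qshᵗ-+₃ (n ∷ v) w _ _ _) (qshᵗ-+₃ v w _ _ _)))
     (trans (solve 9 (λ a₁ b₁ c₁ a₂ b₂ c₂ a₃ b₃ c₃ →
                        ((a₁ ⊕ (b₁ ⊕ c₁)) ⊕ ((a₂ ⊕ (b₂ ⊕ c₂)) ⊕ (a₃ ⊕ (b₃ ⊕ c₃)))) ⊜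
                        ((a₁ ⊕ (a₂ ⊕ a₃)) ⊕ (b₁ ⊕ (b₂ ⊕ (c₁ ⊕ (c₂ ⊕ (b₃ ⊕ c₃)))))))
                     refl _ _ _ _ _ _ _ _ _)
            (+-cong refl (+-cong refl (+-cong refl (+-cong refl (+-cong refl (+-cong refl reassociate)))))))
    where
    reassociate : qshᵗ v w (λ t → qshᵗ u t (λ s → f (m ℤ.+ (n ℤ.+ p) ∷ s)))
                ≈ qshᵗ v w (λ t → qshᵗ u t (λ s → f (m ℤ.+ n ℤ.+ p ∷ s)))
    reassociate = qshᵗ-cong v w (λ t → qshᵗ-cong u t (λ s →
                    reflexive (≡.cong (λ k → f (k ∷ s)) (≡.sym (ℤP.+-assoc m n p)))))

  qshᵗ-assoc : ∀ u v w f → qshᵗ₃ˡ u v w f ≈ qshᵗ₃ʳ u v w f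
  qshᵗ-assoc []      v       w       f = refl
  qshᵗ-assoc (m ∷ u) []      w       f = refl
  qshᵗ-assoc (m ∷ u) (n ∷ v) []      f = qshᵗ-cong (m ∷ u) (n ∷ v) (λ t → reflexive (qshᵗ-[]ʳ t f))
  qshᵗ-assoc (m ∷ u) (n ∷ v) (p ∷ w) f = begin
    qshᵗ₃ˡ (m ∷ u) (n ∷ v) (p ∷ w) f          ≈⟨ qshᵗ₃ˡ-firstLetter m u n v p w f ⟩
    firstLetterSum qshᵗ₃ˡ m u n v p w f
      ≈⟨ +-cong (qshᵗ-assoc u (n ∷ v) (p ∷ w) _) (+-cong (qshᵗ-assoc (m ∷ u) v (p ∷ w) _)
           (+-cong (qshᵗ-assoc (m ∷ u) (n ∷ v) w _) (+-cong (qshᵗ-assoc u v (p ∷ w) _)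
           (+-cong (qshᵗ-assoc u (n ∷ v) w _) (+-cong (qshᵗ-assoc (m ∷ u) v w _) (qshᵗ-assoc u v w _)))))) ⟩
    firstLetterSum qshᵗ₃ʳ m u n v p w f       ≈⟨ qshᵗ₃ʳ-firstLetter m u n v p w f ⟨
    qshᵗ₃ʳ (m ∷ u) (n ∷ v) (p ∷ w) f          ∎

  ∑split : Word → (Word → Word → Carrier) → Carrier
  ∑split []      h = h [] [] + 0#
  ∑split (a ∷ w) h = h [] (a ∷ w) + ∑split w (λ u v → h (a ∷ u) v)

  ∑properSplit : Word → (Word → Word → Carrier) → Carrier
  ∑properSplit []      h = 0#
  ∑properSplit (a ∷ w) h = h [] (a ∷ w) + ∑properSplit w (λ u v → h (a ∷ u) v)

  ∑-splits : ∀ w h → ∑ (splits w) (λ (u , v) → h u v) ≡ ∑split w h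
  ∑-splits []      h = ≡.refl
  ∑-splits (a ∷ w) h = ≡.cong (h [] (a ∷ w) +_) (≡.trans (∑-map _ (splits w) _) (∑-splits w (λ u v → h (a ∷ u) v)))

  ∑-properSplits : ∀ w h → ∑ (properSplits w) (λ (u , v) → h u v) ≡ ∑properSplit w h
  ∑-properSplits []      h = ≡.refl
  ∑-properSplits (a ∷ w) h =
    ≡.cong (h [] (a ∷ w) +_) (≡.trans (∑-map _ (properSplits w) _) (∑-properSplits w (λ u v → h (a ∷ u) v)))

  ∑split-cong : ∀ w {h g} → (∀ a b → h a b ≈ g a b) → ∑split w h ≈ ∑split w g
  ∑split-cong []      h≈g = +-cong (h≈g [] []) refl
  ∑split-cong (x ∷ w) h≈g = +-cong (h≈g [] (x ∷ w)) (∑split-cong w (λ a b → h≈g (x ∷ a) b))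

  ∑split-cong-≤ : ∀ w {h g} → (∀ a b → length a ≤ length w → h a b ≈ g a b) → ∑split w h ≈ ∑split w g
  ∑split-cong-≤ []      h≈g = +-cong (h≈g [] [] z≤n) refl
  ∑split-cong-≤ (x ∷ w) h≈g = +-cong (h≈g [] (x ∷ w) z≤n) (∑split-cong-≤ w (λ a b le → h≈g (x ∷ a) b (s≤s le)))

  ∑properSplit-cong-< : ∀ w {h g} → (∀ a b → length a < length w → h a b ≈ g a b) →
                        ∑properSplit w h ≈ ∑properSplit w g
  ∑properSplit-cong-< []      h≈g = refl
  ∑properSplit-cong-< (x ∷ w) h≈g =
    +-cong (h≈g [] (x ∷ w) (s≤s z≤n)) (∑properSplit-cong-< w (λ a b lt → h≈g (x ∷ a) b (s≤s lt)))

  ∑split-isLinear : ∀ w → IsLinear (λ (h : Word × Word → Carrier) → ∑split w (λ a b → h (a , b)))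
  ∑split-isLinear w = record
    { lin-cong = λ h≈g → ∑split-cong w (λ a b → h≈g (a , b))
    ; lin-+    = λ h g → additive w (λ a b → h (a , b)) (λ a b → g (a , b))
    ; lin-*    = λ r h → homogeneous w r (λ a b → h (a , b))
    }
    where
    additive : ∀ w h g → ∑split w (λ a b → h a b + g a b) ≈ ∑split w h + ∑split w g
    additive []      h g = trans (+-identityʳ _) (sym (+-cong (+-identityʳ _) (+-identityʳ _)))
    additive (x ∷ w) h g = trans (+-cong refl (additive w _ _)) (+-interchange _ _ _ _)
    homogeneous : ∀ w r h → ∑split w (λ a b → r * h a b) ≈ r * ∑split w h
    homogeneous []      r h = trans (+-cong refl (sym (zeroʳ r))) (sym (distribˡ _ _ _))
    homogeneous (x ∷ w) r h = trans (+-cong refl (homogeneous w r _)) (sym (distribˡ _ _ _))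

  ∑split-+ : ∀ w h g → ∑split w (λ a b → h a b + g a b) ≈ ∑split w h + ∑split w g
  ∑split-+ w h g = lin-+ (∑split-isLinear w) (λ (a , b) → h a b) (λ (a , b) → g a b)

  ∑split-*ˡ : ∀ w r h → ∑split w (λ a b → r * h a b) ≈ r * ∑split w h
  ∑split-*ˡ w r h = lin-* (∑split-isLinear w) r (λ (a , b) → h a b)

  ∑split-*ʳ : ∀ w r h → ∑split w (λ a b → h a b * r) ≈ ∑split w h * r
  ∑split-*ʳ w r h = lin-*ʳ (∑split-isLinear w) r (λ (a , b) → h a b)

  ∑split-vanish : ∀ w {h} → (∀ a b → a ++ b ≡ w → h a b ≈ 0#) → ∑split w h ≈ 0#
  ∑split-vanish []      h≈0 = trans (+-identityʳ _) (h≈0 [] [] ≡.refl)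
  ∑split-vanish (x ∷ w) h≈0 =
    trans (+-cong (h≈0 [] (x ∷ w) ≡.refl) (∑split-vanish w (λ a b ab≡w → h≈0 (x ∷ a) b (≡.cong (x ∷_) ab≡w))))
          (+-identityʳ 0#)

  ∑split-comm : ∀ {K : Set} w {L : (K → Carrier) → Carrier} → IsLinear L → (f : Word → Word → K → Carrier) →
                L (λ k → ∑split w (λ a b → f a b k)) ≈ ∑split w (λ a b → L (f a b))
  ∑split-comm []      L-lin f = trans (lin-cong L-lin (λ k → +-identityʳ _)) (sym (+-identityʳ _))
  ∑split-comm (x ∷ w) L-lin f = trans (lin-+ L-lin _ _) (+-cong refl (∑split-comm w L-lin (λ a b → f (x ∷ a) b)))

  ∑split-last : ∀ w h → ∑split w h ≈ h w [] + ∑properSplit w h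
  ∑split-last []      h = refl
  ∑split-last (x ∷ w) h = trans (+-cong refl (∑split-last w _)) (x+yz≈y+xz _ _ _)

  -- Δ (u ∗ v) = Δ u ∗ Δ v, paired with c
  qshᵗ-∑split : ∀ u v (c : Word → Word → Carrier) →
    qshᵗ u v (λ t → ∑split t c) ≈ ∑split u (λ u₁ u₂ → ∑split v (λ v₁ v₂ → qshᵗ u₁ v₁ (λ a → qshᵗ u₂ v₂ (c a))))
  qshᵗ-∑split []      v       c = sym (+-identityʳ _)
  qshᵗ-∑split (m ∷ u) []      c = ∑split-cong (m ∷ u) (λ a b → sym (trans (+-identityʳ _)
                                    (reflexive (≡.trans (qshᵗ-[]ʳ a (λ x → qshᵗ b [] (c x))) (qshᵗ-[]ʳ b (c a))))))
  qshᵗ-∑split (m ∷ u) (n ∷ v) c = begin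
    qshᵗ (m ∷ u) (n ∷ v) (λ t → ∑split t c)
      ≈⟨ +-cong (lin-+ (qshᵗ-isLinear u (n ∷ v)) _ _)
                (+-cong (lin-+ (qshᵗ-isLinear (m ∷ u) v) _ _) (lin-+ (qshᵗ-isLinear u v) _ _)) ⟩
    (qshᵗ u (n ∷ v) (λ t → c [] (m ∷ t)) + qshᵗ u (n ∷ v) (λ t → ∑split t (λ a → c (m ∷ a)))) +
    ((qshᵗ (m ∷ u) v (λ t → c [] (n ∷ t)) + qshᵗ (m ∷ u) v (λ t → ∑split t (λ a → c (n ∷ a)))) +
     (qshᵗ u v (λ t → c [] (m ℤ.+ n ∷ t)) + qshᵗ u v (λ t → ∑split t (λ a → c (m ℤ.+ n ∷ a)))))
      ≈⟨ +-cong (+-cong refl (trans (qshᵗ-∑split u (n ∷ v) _) SCˡ))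
                (+-cong (+-cong refl (qshᵗ-∑split (m ∷ u) v _)) (+-cong refl (qshᵗ-∑split u v _))) ⟩
    (_ + (SC + SD₁)) + ((_ + (B + SD₂)) + (_ + SD₃))
      ≈⟨ solve 9 (λ a₁ a₂ a₃ b sc d₁ d₂ d₃ z →
                    ((a₁ ⊕ (sc ⊕ d₁)) ⊕ ((a₂ ⊕ (b ⊕ d₂)) ⊕ (a₃ ⊕ d₃))) ⊜
                    ((a₁ ⊕ (a₂ ⊕ a₃)) ⊕ (b ⊕ (sc ⊕ (d₁ ⊕ (d₂ ⊕ d₃))))))
                 refl _ _ _ B SC SD₁ SD₂ SD₃ 0# ⟩
    B₀ + (B + (SC + (SD₁ + (SD₂ + SD₃))))
      ≈⟨ rhs ⟨
    ∑split (m ∷ u) (λ u₁ u₂ → ∑split (n ∷ v) (λ v₁ v₂ → qshᵗ u₁ v₁ (λ a → qshᵗ u₂ v₂ (c a)))) ∎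
    where
    D : ℤ → Word → Word → Word → Word → Carrier
    D k u₁ u₂ v₁ v₂ = qshᵗ u₁ v₁ (λ a → qshᵗ u₂ v₂ (c (k ∷ a)))
    D₁ D₂ D₃ : Word → Word → Word → Word → Carrier
    D₁ u₁ u₂ v₁ v₂ = qshᵗ u₁ (n ∷ v₁) (λ a → qshᵗ u₂ v₂ (c (m ∷ a)))
    D₂ u₁ u₂ v₁ v₂ = qshᵗ (m ∷ u₁) v₁ (λ a → qshᵗ u₂ v₂ (c (n ∷ a)))
    D₃ u₁ u₂ v₁ v₂ = D (m ℤ.+ n) u₁ u₂ v₁ v₂
    B₀ B SC SD₁ SD₂ SD₃ : Carrier
    B₀  = qshᵗ (m ∷ u) (n ∷ v) (c [])
    B   = ∑split v (λ v₁ v₂ → qshᵗ (m ∷ u) v₂ (c (n ∷ v₁)))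
    SC  = ∑split u (λ u₁ u₂ → qshᵗ u₂ (n ∷ v) (c (m ∷ u₁)))
    SD₁ = ∑split u (λ u₁ u₂ → ∑split v (D₁ u₁ u₂))
    SD₂ = ∑split u (λ u₁ u₂ → ∑split v (D₂ u₁ u₂))
    SD₃ = ∑split u (λ u₁ u₂ → ∑split v (D₃ u₁ u₂))
    SCˡ : ∑split u (λ u₁ u₂ → ∑split (n ∷ v) (D m u₁ u₂)) ≈ SC + SD₁
    SCˡ = trans (∑split-+ u _ _) (+-cong (∑split-cong u (λ u₁ u₂ → reflexive (qshᵗ-[]ʳ u₁ _))) refl)
    rhs : ∑split (m ∷ u) (λ u₁ u₂ → ∑split (n ∷ v) (λ v₁ v₂ → qshᵗ u₁ v₁ (λ a → qshᵗ u₂ v₂ (c a))))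
        ≈ B₀ + (B + (SC + (SD₁ + (SD₂ + SD₃))))
    rhs = trans (+-assoc B₀ B _) (+-cong refl (+-cong refl (begin
      ∑split u (λ u₁ u₂ → qshᵗ u₂ (n ∷ v) (c (m ∷ u₁)) + ∑split v (λ v₁ v₂ → D₁ u₁ u₂ v₁ v₂ + (D₂ u₁ u₂ v₁ v₂ + D₃ u₁ u₂ v₁ v₂)))
        ≈⟨ ∑split-+ u _ _ ⟩
      SC + ∑split u (λ u₁ u₂ → ∑split v (λ v₁ v₂ → D₁ u₁ u₂ v₁ v₂ + (D₂ u₁ u₂ v₁ v₂ + D₃ u₁ u₂ v₁ v₂)))
        ≈⟨ +-cong refl (trans (∑split-cong u (λ u₁ u₂ → trans (∑split-+ v _ _) (+-cong refl (∑split-+ v _ _))))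
                              (trans (∑split-+ u _ _) (+-cong refl (∑split-+ u _ _)))) ⟩
      SC + (SD₁ + (SD₂ + SD₃)) ∎)))

  Sᵗ : Word → (Word → Carrier) → Carrier
  Sᵗ u f = ⟦ Sword u ⟧ f

  Sᵗ-unfold : ∀ a w f → Sᵗ (a ∷ w) f ≈ - ∑properSplit (a ∷ w) (λ x y → Sᵗ x (λ α → qshᵗ α y f))
  Sᵗ-unfold a w f = begin
    ⟦ negH (concatMap S₁ (properSplits (a ∷ w))) ⟧ f
      ≈⟨ ⟦negH⟧ (concatMap S₁ (properSplits (a ∷ w))) f ⟩
    - ⟦ concatMap S₁ (properSplits (a ∷ w)) ⟧ f
      ≈⟨ -‿cong (⟦⟧-concatMap S₁ (properSplits (a ∷ w)) f) ⟩
    - ∑ (properSplits (a ∷ w)) (λ (x , y) → ⟦ Sfuel (length w) x ∗ word y ⟧ f)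
      ≡⟨ ≡.cong -_ (∑-properSplits (a ∷ w) (λ x y → ⟦ Sfuel (length w) x ∗ word y ⟧ f)) ⟩
    - ∑properSplit (a ∷ w) (λ x y → ⟦ Sfuel (length w) x ∗ word y ⟧ f)
      ≈⟨ -‿cong (∑properSplit-cong-< (a ∷ w) (λ x y x<aw → begin
           ⟦ Sfuel (length w) x ∗ word y ⟧ f
             ≈⟨ ⟦∗⟧ (Sfuel (length w) x) (word y) f ⟩
           ⟦ Sfuel (length w) x ⟧ (λ α → ⟦ word y ⟧ (λ β → qshᵗ α β f))
             ≈⟨ ⟦⟧-cong (Sfuel (length w) x) (λ α → ⟦word⟧ y (λ β → qshᵗ α β f)) ⟩
           ⟦ Sfuel (length w) x ⟧ (λ α → qshᵗ α y f)
             ≡⟨ ≡.cong (⟦_⟧ (λ α → qshᵗ α y f)) (Sfuel-stable x (ℕP.≤-pred x<aw) ℕP.≤-refl) ⟩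
           Sᵗ x (λ α → qshᵗ α y f) ∎)) ⟩
    - ∑properSplit (a ∷ w) (λ x y → Sᵗ x (λ α → qshᵗ α y f)) ∎
    where
    S₁ : Word × Word → Lin
    S₁ (u , v) = Sfuel (length w) u ∗ word v

  counit : Word → Carrier
  counit []      = 1#
  counit (_ ∷ _) = 0#

  -- the antipode axiom  m ∘ (S ⊗ id) ∘ Δ = η ∘ ε, paired with f
  Sᵗ-antipode : ∀ t f → ∑split t (λ a b → Sᵗ a (λ α → qshᵗ α b f)) ≈ counit t * f []
  Sᵗ-antipode []      f = trans (+-identityʳ _) (trans (+-identityʳ _) (*-congʳ ι-1))
  Sᵗ-antipode (x ∷ t) f = begin
    ∑split (x ∷ t) h                                ≈⟨ ∑split-last (x ∷ t) h ⟩
    h (x ∷ t) [] + ∑properSplit (x ∷ t) h           ≈⟨ +-cong (trans (⟦⟧-cong (Sword (x ∷ t)) (λ α → reflexive (qshᵗ-[]ʳ α f)))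
                                                                       (Sᵗ-unfold x t f)) refl ⟩
    - ∑properSplit (x ∷ t) h + ∑properSplit (x ∷ t) h ≈⟨ -‿inverseˡ _ ⟩
    0#                                              ≈⟨ zeroˡ _ ⟨
    0# * f []                                       ∎
    where
    h : Word → Word → Carrier
    h a b = Sᵗ a (λ α → qshᵗ α b f)

  qshᵗ-counit : ∀ u v r → qshᵗ u v (λ t → counit t * r) ≈ counit u * (counit v * r)
  qshᵗ-counit []      v       r = sym (*-identityˡ _)
  qshᵗ-counit (m ∷ u) []      r = trans (zeroˡ r) (sym (zeroˡ _))
  qshᵗ-counit (m ∷ u) (n ∷ v) r = begin
    qshᵗ (m ∷ u) (n ∷ v) (λ t → counit t * r)  ≈⟨ +-cong (vanish u (n ∷ v) m) (+-cong (vanish (m ∷ u) v n) (vanish u v (m ℤ.+ n))) ⟩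
    0# + (0# + 0#)                             ≈⟨ trans (+-identityˡ _) (+-identityʳ 0#) ⟩
    0#                                         ≈⟨ zeroˡ _ ⟨
    0# * (0# * r)                              ∎
    where
    vanish : ∀ a b k → qshᵗ a b (λ t → counit (k ∷ t) * r) ≈ 0#
    vanish a b k = lin-vanish (qshᵗ-isLinear a b) (λ _ → zeroˡ r)

  qshᵗ-interchange : ∀ a b c d f →
    qshᵗ a b (λ α → qshᵗ c d (λ β → qshᵗ α β f)) ≈ qshᵗ a c (λ x → qshᵗ b d (λ y → qshᵗ x y f))
  qshᵗ-interchange a b c d f = begin
    qshᵗ a b (λ α → qshᵗ c d (λ β → qshᵗ α β f))  ≈⟨ qshᵗ-cong a b (λ α → qshᵗ-assoc α c d f) ⟨
    qshᵗ a b (λ α → qshᵗ α c (λ t → qshᵗ t d f))  ≈⟨ qshᵗ-assoc a b c _ ⟩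
    qshᵗ b c (λ s → qshᵗ a s (λ t → qshᵗ t d f))  ≈⟨ qshᵗ-comm b c _ ⟩
    qshᵗ c b (λ s → qshᵗ a s (λ t → qshᵗ t d f))  ≈⟨ qshᵗ-assoc a c b _ ⟨
    qshᵗ a c (λ x → qshᵗ x b (λ t → qshᵗ t d f))  ≈⟨ qshᵗ-cong a c (λ x → qshᵗ-assoc x b d f) ⟩
    qshᵗ a c (λ x → qshᵗ b d (λ y → qshᵗ x y f))  ∎

  antipodeOfProduct productOfAntipodes : Word → Word → (Word → Carrier) → Carrier
  antipodeOfProduct  u v f = qshᵗ u v (λ t → Sᵗ t f)
  productOfAntipodes u v f = Sᵗ u (λ α → Sᵗ v (λ β → qshᵗ α β f))

  -- Σ L(u₁, v₁) ∗ u₂ ∗ v₂ over u₁u₂ = u and v₁v₂ = v, paired with f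
  convolveWithId : (Word → Word → (Word → Carrier) → Carrier) → Word → Word → (Word → Carrier) → Carrier
  convolveWithId L u v f = ∑split u (λ u₁ u₂ → ∑split v (λ v₁ v₂ → L u₁ v₁ (λ α → qshᵗ u₂ v₂ (λ β → qshᵗ α β f))))

  convolveWithId-last : ∀ {L} → (∀ u v {f g} → (∀ t → f t ≈ g t) → L u v f ≈ L u v g) → ∀ u v f →
    convolveWithId L u v f ≈
    L u v f + (∑properSplit v (λ v₁ v₂ → L u v₁ (λ α → qshᵗ [] v₂ (λ β → qshᵗ α β f))) +
               ∑properSplit u (λ u₁ u₂ → ∑split v (λ v₁ v₂ → L u₁ v₁ (λ α → qshᵗ u₂ v₂ (λ β → qshᵗ α β f)))))
  convolveWithId-last L-cong u v f =
    trans (∑split-last u _)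
      (trans (+-cong (trans (∑split-last v _) (+-cong (L-cong u v (λ α → reflexive (qshᵗ-[]ʳ α f))) refl)) refl)
             (+-assoc _ _ _))

  convolveWithId-antipodeOfProduct : ∀ u v f → convolveWithId antipodeOfProduct u v f ≈ counit u * (counit v * f [])
  convolveWithId-antipodeOfProduct u v f = begin
    convolveWithId antipodeOfProduct u v f
      ≈⟨ ∑split-cong u (λ u₁ u₂ → ∑split-cong v (λ v₁ v₂ → qshᵗ-cong u₁ v₁ (λ t →
           ⟦⟧-comm (Sword t) (qshᵗ-isLinear u₂ v₂) (λ α β → qshᵗ α β f)))) ⟩
    ∑split u (λ u₁ u₂ → ∑split v (λ v₁ v₂ → qshᵗ u₁ v₁ (λ a → qshᵗ u₂ v₂ (h a))))
      ≈⟨ qshᵗ-∑split u v h ⟨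
    qshᵗ u v (λ t → ∑split t h)
      ≈⟨ qshᵗ-cong u v (λ t → Sᵗ-antipode t f) ⟩
    qshᵗ u v (λ t → counit t * f [])
      ≈⟨ qshᵗ-counit u v (f []) ⟩
    counit u * (counit v * f []) ∎
    where
    h : Word → Word → Carrier
    h a b = Sᵗ a (λ α → qshᵗ α b f)

  convolveWithId-productOfAntipodes : ∀ u v f → convolveWithId productOfAntipodes u v f ≈ counit u * (counit v * f [])
  convolveWithId-productOfAntipodes u v f = begin
    convolveWithId productOfAntipodes u v f
      ≈⟨ ∑split-cong u (λ u₁ u₂ → ∑split-cong v (λ v₁ v₂ → interchanged u₁ u₂ v₁ v₂)) ⟩
    ∑split u (λ u₁ u₂ → ∑split v (λ v₁ v₂ → Sᵗ u₁ (λ α → qshᵗ α u₂ (λ x → N x v₁ v₂))))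
      ≈⟨ ∑split-cong u (λ u₁ u₂ → sym (∑split-comm v (Sᵗ∘qshᵗ-isLinear u₁ u₂) (λ v₁ v₂ x → N x v₁ v₂))) ⟩
    ∑split u (λ u₁ u₂ → Sᵗ u₁ (λ α → qshᵗ α u₂ (λ x → ∑split v (N x))))
      ≈⟨ ∑split-cong u (λ u₁ u₂ → ⟦⟧-cong (Sword u₁) (λ α → qshᵗ-cong α u₂ (λ x →
           trans (Sᵗ-antipode v (λ y → qshᵗ x y f)) (*-congˡ (reflexive (qshᵗ-[]ʳ x f)))))) ⟩
    ∑split u (λ u₁ u₂ → Sᵗ u₁ (λ α → qshᵗ α u₂ (λ x → counit v * f x)))
      ≈⟨ ∑split-cong u (λ u₁ u₂ → lin-* (Sᵗ∘qshᵗ-isLinear u₁ u₂) (counit v) f) ⟩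
    ∑split u (λ u₁ u₂ → counit v * Sᵗ u₁ (λ α → qshᵗ α u₂ f))
      ≈⟨ ∑split-*ˡ u (counit v) _ ⟩
    counit v * ∑split u (λ u₁ u₂ → Sᵗ u₁ (λ α → qshᵗ α u₂ f))
      ≈⟨ *-congˡ (Sᵗ-antipode u f) ⟩
    counit v * (counit u * f [])
      ≈⟨ x*yz≈y*xz (counit v) (counit u) (f []) ⟩
    counit u * (counit v * f []) ∎
    where
    N : Word → Word → Word → Carrier
    N x v₁ v₂ = Sᵗ v₁ (λ β → qshᵗ β v₂ (λ y → qshᵗ x y f))
    Sᵗ∘qshᵗ-isLinear : ∀ u₁ u₂ → IsLinear (λ g → Sᵗ u₁ (λ α → qshᵗ α u₂ g))
    Sᵗ∘qshᵗ-isLinear u₁ u₂ = ∘-isLinear (⟦⟧-isLinear (Sword u₁)) (λ α → qshᵗ-isLinear α u₂)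
    interchanged : ∀ u₁ u₂ v₁ v₂ →
      productOfAntipodes u₁ v₁ (λ α → qshᵗ u₂ v₂ (λ β → qshᵗ α β f)) ≈ Sᵗ u₁ (λ α → qshᵗ α u₂ (λ x → N x v₁ v₂))
    interchanged u₁ u₂ v₁ v₂ = ⟦⟧-cong (Sword u₁) (λ α →
      trans (⟦⟧-cong (Sword v₁) (λ β → qshᵗ-interchange α β u₂ v₂ f))
            (⟦⟧-comm (Sword v₁) (qshᵗ-isLinear α u₂) (λ β x → qshᵗ β v₂ (λ y → qshᵗ x y f))))

  -- Both convolutions equal ε(u) ε(v); their leading terms are the two sides,
  -- and the remaining terms agree by induction on |u| + |v|.
  Sᵗ-∗ : ∀ u v f → antipodeOfProduct u v f ≈ productOfAntipodes u v f
  Sᵗ-∗ u v = go (suc (length u ℕ.+ length v)) u v ℕP.≤-refl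
    where
    antipodeOfProduct-cong : ∀ u v {f g} → (∀ t → f t ≈ g t) → antipodeOfProduct u v f ≈ antipodeOfProduct u v g
    antipodeOfProduct-cong u v f≈g = qshᵗ-cong u v (λ t → ⟦⟧-cong (Sword t) f≈g)
    productOfAntipodes-cong : ∀ u v {f g} → (∀ t → f t ≈ g t) → productOfAntipodes u v f ≈ productOfAntipodes u v g
    productOfAntipodes-cong u v f≈g = ⟦⟧-cong (Sword u) (λ α → ⟦⟧-cong (Sword v) (λ β → qshᵗ-cong α β f≈g))
    go : ∀ n u v → length u ℕ.+ length v < n → ∀ f → antipodeOfProduct u v f ≈ productOfAntipodes u v f
    go (suc n) u v (s≤s |uv|≤n) f = +-cancelʳ _ _ _ (begin
      antipodeOfProduct u v f + lower antipodeOfProduct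
        ≈⟨ convolveWithId-last antipodeOfProduct-cong u v f ⟨
      convolveWithId antipodeOfProduct u v f
        ≈⟨ trans (convolveWithId-antipodeOfProduct u v f) (sym (convolveWithId-productOfAntipodes u v f)) ⟩
      convolveWithId productOfAntipodes u v f
        ≈⟨ convolveWithId-last productOfAntipodes-cong u v f ⟩
      productOfAntipodes u v f + lower productOfAntipodes
        ≈⟨ +-cong refl lower-agree ⟨
      productOfAntipodes u v f + lower antipodeOfProduct ∎)
      where
      lower : (Word → Word → (Word → Carrier) → Carrier) → Carrier
      lower L = ∑properSplit v (λ v₁ v₂ → L u v₁ (λ α → qshᵗ [] v₂ (λ β → qshᵗ α β f))) +
                ∑properSplit u (λ u₁ u₂ → ∑split v (λ v₁ v₂ → L u₁ v₁ (λ α → qshᵗ u₂ v₂ (λ β → qshᵗ α β f))))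
      lower-agree : lower antipodeOfProduct ≈ lower productOfAntipodes
      lower-agree = +-cong
        (∑properSplit-cong-< v (λ v₁ v₂ v₁<v →
           go n u v₁ (ℕP.<-≤-trans (ℕP.+-monoʳ-< (length u) v₁<v) |uv|≤n) _))
        (∑properSplit-cong-< u (λ u₁ u₂ u₁<u → ∑split-cong-≤ v (λ v₁ v₂ v₁≤v →
           go n u₁ v₁ (ℕP.<-≤-trans (ℕP.+-mono-<-≤ u₁<u v₁≤v) |uv|≤n) _)))

  module Comb₂ = Combination (×P.≡-dec (≡-dec ℤ._≟_) (≡-dec ℤ._≟_))

  infix 20 ⟦_⟧₂_
  ⟦_⟧₂_ : Lin₂ → (Word → Word → Carrier) → Carrier
  ⟦ t ⟧₂ f = Comb₂.⟦ t ⟧ (λ k → f (proj₁ k) (proj₂ k))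

  ⟦⟧₂-cong : ∀ t {f g} → (∀ a b → f a b ≈ g a b) → ⟦ t ⟧₂ f ≈ ⟦ t ⟧₂ g
  ⟦⟧₂-cong t f≈g = Comb₂.⟦⟧-cong t (λ k → f≈g (proj₁ k) (proj₂ k))

  ⟦⟧₂-++ : ∀ s t f → ⟦ s ++ t ⟧₂ f ≈ ⟦ s ⟧₂ f + ⟦ t ⟧₂ f
  ⟦⟧₂-++ s t f = Comb₂.⟦⟧-++ s t _

  coefficient₂≡coeff₂ : ∀ t a b → Comb₂.coefficient t (a , b) ≡ coeff₂ t a b
  coefficient₂≡coeff₂ []                a b = ≡.refl
  coefficient₂≡coeff₂ ((q , u , v) ∷ t) a b with ×P.≡-dec (≡-dec ℤ._≟_) (≡-dec ℤ._≟_) (u , v) (a , b)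
  coefficient₂≡coeff₂ ((q , u , v) ∷ t) a b | yes ≡.refl with ≡-dec ℤ._≟_ u u | ≡-dec ℤ._≟_ v v
  ... | yes _   | yes _   = ≡.cong (q ℚ.+_) (coefficient₂≡coeff₂ t a b)
  ... | no  u≢u | _       = contradiction ≡.refl u≢u
  ... | yes _   | no  v≢v = contradiction ≡.refl v≢v
  coefficient₂≡coeff₂ ((q , u , v) ∷ t) a b | no uv≢ab with ≡-dec ℤ._≟_ u a | ≡-dec ℤ._≟_ v b
  ... | yes ≡.refl | yes ≡.refl = contradiction ≡.refl uv≢ab
  ... | yes _      | no  _      = coefficient₂≡coeff₂ t a b
  ... | no  _      | _          = coefficient₂≡coeff₂ t a b

  ⟦⟧₂-resp-≈₂ : ∀ {s t} → s ≈₂ t → ∀ f → ⟦ s ⟧₂ f ≈ ⟦ t ⟧₂ f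
  ⟦⟧₂-resp-≈₂ {s} {t} s≈t f = Comb₂.⟦⟧-resp-coefficient s t _ λ (a , b) →
    ≡.trans (coefficient₂≡coeff₂ s a b) (≡.trans (s≈t a b) (≡.sym (coefficient₂≡coeff₂ t a b)))

  ⟦⊗⟧₂ : ∀ x y f → ⟦ x ⊗ y ⟧₂ f ≈ ⟦ x ⟧ (λ u → ⟦ y ⟧ (λ v → f u v))
  ⟦⊗⟧₂ x y f = begin
    ⟦ x ⊗ y ⟧₂ f
      ≈⟨ Comb₂.⟦⟧-concatMap _ x _ ⟩
    ∑ x (λ (p , u) → ⟦ map (λ (q , v) → (p ℚ.* q , u , v)) y ⟧₂ f)
      ≈⟨ ∑-cong x (λ (p , u) → row p u) ⟩
    ∑ x (λ (p , u) → ι p * ⟦ y ⟧ (λ v → f u v))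
      ≡⟨ ⟦⟧-as-∑ x _ ⟨
    ⟦ x ⟧ (λ u → ⟦ y ⟧ (λ v → f u v)) ∎
    where
    row : ∀ p u → ⟦ map (λ (q , v) → (p ℚ.* q , u , v)) y ⟧₂ f ≈ ι p * ⟦ y ⟧ (λ v → f u v)
    row p u = begin
      ⟦ map (λ (q , v) → (p ℚ.* q , u , v)) y ⟧₂ f
        ≡⟨ ≡.trans (Comb₂.⟦⟧-as-∑ (map _ y) _) (∑-map _ y _) ⟩
      ∑ y (λ (q , v) → ι (p ℚ.* q) * f u v)
        ≈⟨ ∑-cong y (λ (q , v) → trans (*-congʳ (ι-* p q)) (*-assoc _ _ _)) ⟩
      ∑ y (λ (q , v) → ι p * (ι q * f u v))
        ≈⟨ ∑-*ˡ y (ι p) _ ⟩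
      ι p * ∑ y (λ (q , v) → ι q * f u v)
        ≡⟨ ≡.cong (ι p *_) (⟦⟧-as-∑ y _) ⟨
      ι p * ⟦ y ⟧ (λ v → f u v) ∎

  ⟦Δ⟧₂ : ∀ x f → ⟦ Δ x ⟧₂ f ≈ ⟦ x ⟧ (λ w → ∑split w f)
  ⟦Δ⟧₂ x f = begin
    ⟦ Δ x ⟧₂ f
      ≈⟨ Comb₂.⟦⟧-concatMap _ x _ ⟩
    ∑ x (λ (q , w) → ⟦ map (λ (u , v) → (q , u , v)) (splits w) ⟧₂ f)
      ≈⟨ ∑-cong x (λ (q , w) → reflexive (row q w)) ⟩
    ∑ x (λ (q , w) → ∑split w (λ u v → ι q * f u v))
      ≈⟨ ∑-cong x (λ (q , w) → ∑split-*ˡ w (ι q) f) ⟩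
    ∑ x (λ (q , w) → ι q * ∑split w f)
      ≡⟨ ⟦⟧-as-∑ x _ ⟨
    ⟦ x ⟧ (λ w → ∑split w f) ∎
    where
    row : ∀ q w → ⟦ map (λ (u , v) → (q , u , v)) (splits w) ⟧₂ f ≡ ∑split w (λ u v → ι q * f u v)
    row q w = ≡.trans (Comb₂.⟦⟧-as-∑ (map _ (splits w)) _)
                (≡.trans (∑-map _ (splits w) _) (∑-splits w (λ u v → ι q * f u v)))

  ⟦∗₂⟧₂ : ∀ s t f → ⟦ s ∗₂ t ⟧₂ f ≈ ⟦ s ⟧₂ (λ a b → ⟦ t ⟧₂ (λ c d → qshᵗ a c (λ x → qshᵗ b d (f x))))
  ⟦∗₂⟧₂ s t f = begin
    ⟦ s ∗₂ t ⟧₂ f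
      ≈⟨ Comb₂.⟦⟧-concatMap _ s _ ⟩
    ∑ s (λ (p , a , b) → ⟦ concatMap (λ (q , c , d) → scale (p ℚ.* q) (qsh a c) ⊗ qsh b d) t ⟧₂ f)
      ≈⟨ ∑-cong s (λ (p , a , b) → row p a b) ⟩
    ∑ s (λ (p , a , b) → ι p * ⟦ t ⟧₂ (λ c d → qshᵗ a c (λ x → qshᵗ b d (f x))))
      ≡⟨ Comb₂.⟦⟧-as-∑ s _ ⟨
    ⟦ s ⟧₂ (λ a b → ⟦ t ⟧₂ (λ c d → qshᵗ a c (λ x → qshᵗ b d (f x)))) ∎
    where
    entry : ∀ r a b c d → ⟦ scale r (qsh a c) ⊗ qsh b d ⟧₂ f ≈ ι r * qshᵗ a c (λ x → qshᵗ b d (f x))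
    entry r a b c d = begin
      ⟦ scale r (qsh a c) ⊗ qsh b d ⟧₂ f                 ≈⟨ ⟦⊗⟧₂ (scale r (qsh a c)) (qsh b d) f ⟩
      ⟦ scale r (qsh a c) ⟧ (λ x → ⟦ qsh b d ⟧ (f x))     ≈⟨ ⟦⟧-cong (scale r (qsh a c)) (λ x → ⟦qsh⟧ b d (f x)) ⟩
      ⟦ scale r (qsh a c) ⟧ (λ x → qshᵗ b d (f x))        ≈⟨ ⟦scale⟧ r (qsh a c) _ ⟩
      ι r * ⟦ qsh a c ⟧ (λ x → qshᵗ b d (f x))            ≈⟨ *-congˡ (⟦qsh⟧ a c _) ⟩
      ι r * qshᵗ a c (λ x → qshᵗ b d (f x))               ∎
    row : ∀ p a b → ⟦ concatMap (λ (q , c , d) → scale (p ℚ.* q) (qsh a c) ⊗ qsh b d) t ⟧₂ f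
                  ≈ ι p * ⟦ t ⟧₂ (λ c d → qshᵗ a c (λ x → qshᵗ b d (f x)))
    row p a b = begin
      ⟦ concatMap (λ (q , c , d) → scale (p ℚ.* q) (qsh a c) ⊗ qsh b d) t ⟧₂ f
        ≈⟨ Comb₂.⟦⟧-concatMap _ t _ ⟩
      ∑ t (λ (q , c , d) → ⟦ scale (p ℚ.* q) (qsh a c) ⊗ qsh b d ⟧₂ f)
        ≈⟨ ∑-cong t (λ (q , c , d) → trans (entry (p ℚ.* q) a b c d) (trans (*-congʳ (ι-* p q)) (*-assoc _ _ _))) ⟩
      ∑ t (λ (q , c , d) → ι p * (ι q * qshᵗ a c (λ x → qshᵗ b d (f x))))
        ≈⟨ ∑-*ˡ t (ι p) _ ⟩
      ι p * ∑ t (λ (q , c , d) → ι q * qshᵗ a c (λ x → qshᵗ b d (f x)))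
        ≡⟨ ≡.cong (ι p *_) (Comb₂.⟦⟧-as-∑ t _) ⟨
      ι p * ⟦ t ⟧₂ (λ c d → qshᵗ a c (λ x → qshᵗ b d (f x))) ∎

  ⟦Δ∗⟧₂ : ∀ x y f → ⟦ Δ (x ∗ y) ⟧₂ f ≈ ⟦ Δ x ∗₂ Δ y ⟧₂ f
  ⟦Δ∗⟧₂ x y f = begin
    ⟦ Δ (x ∗ y) ⟧₂ f
      ≈⟨ ⟦Δ⟧₂ (x ∗ y) f ⟩
    ⟦ x ∗ y ⟧ (λ w → ∑split w f)
      ≈⟨ ⟦∗⟧ x y _ ⟩
    ⟦ x ⟧ (λ u → ⟦ y ⟧ (λ v → qshᵗ u v (λ w → ∑split w f)))
      ≈⟨ ⟦⟧-cong x (λ u → ⟦⟧-cong y (λ v → qshᵗ-∑split u v f)) ⟩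
    ⟦ x ⟧ (λ u → ⟦ y ⟧ (λ v → ∑split u (λ u₁ u₂ → ∑split v (F u₁ u₂))))
      ≈⟨ ⟦⟧-cong x (λ u → ∑split-comm u (⟦⟧-isLinear y) (λ u₁ u₂ v → ∑split v (F u₁ u₂))) ⟩
    ⟦ x ⟧ (λ u → ∑split u (λ u₁ u₂ → ⟦ y ⟧ (λ v → ∑split v (F u₁ u₂))))
      ≈⟨ ⟦Δ⟧₂ x _ ⟨
    ⟦ Δ x ⟧₂ (λ u₁ u₂ → ⟦ y ⟧ (λ v → ∑split v (F u₁ u₂)))
      ≈⟨ ⟦⟧₂-cong (Δ x) (λ u₁ u₂ → ⟦Δ⟧₂ y (F u₁ u₂)) ⟨
    ⟦ Δ x ⟧₂ (λ u₁ u₂ → ⟦ Δ y ⟧₂ (F u₁ u₂))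
      ≈⟨ ⟦∗₂⟧₂ (Δ x) (Δ y) f ⟨
    ⟦ Δ x ∗₂ Δ y ⟧₂ f ∎
    where
    F : Word → Word → Word → Word → Carrier
    F u₁ u₂ v₁ v₂ = qshᵗ u₁ v₁ (λ a → qshᵗ u₂ v₂ (f a))

  ⟦S⟧ : ∀ x f → ⟦ S x ⟧ f ≈ ⟦ x ⟧ (λ w → Sᵗ w f)
  ⟦S⟧ x f = begin
    ⟦ S x ⟧ f                                  ≈⟨ ⟦⟧-concatMap _ x f ⟩
    ∑ x (λ (q , w) → ⟦ scale q (Sword w) ⟧ f)  ≈⟨ ∑-cong x (λ (q , w) → ⟦scale⟧ q (Sword w) f) ⟩
    ∑ x (λ (q , w) → ι q * Sᵗ w f)             ≡⟨ ⟦⟧-as-∑ x _ ⟨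
    ⟦ x ⟧ (λ w → Sᵗ w f)                       ∎

-- Pairings with ℚ-valued maps determine elements of H and of H ⊗ H

ℚ-algebra : QAlgebra 0ℓ 0ℓ
ℚ-algebra = record
  { commRing = ℚP.+-*-commutativeRing
  ; ι        = λ q → q
  ; ι-hom    = record
    { isSemiringHomomorphism = record
      { isNearSemiringHomomorphism = record
        { +-isMonoidHomomorphism = record
          { isMagmaHomomorphism = record { isRelHomomorphism = record { cong = λ q≡r → q≡r } ; homo = λ _ _ → ≡.refl }
          ; ε-homo = ≡.refl }
        ; *-homo = λ _ _ → ≡.refl }
      ; 1#-homo = ≡.refl }
    ; -‿homo = λ _ → ≡.refl } }

module Q = Pairing ℚ-algebra

module _ {K : Set} (_≟ₖ_ : DecidableEquality K) where
  open Q.Combination _≟ₖ_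

  indicator : K → K → ℚ
  indicator k u with u ≟ₖ k
  ... | yes _ = 1ℚ
  ... | no  _ = 0ℚ

  coefficient-as-⟦⟧ : ∀ x k → coefficient x k ≡ ⟦ x ⟧ indicator k
  coefficient-as-⟦⟧ []            k = ≡.refl
  coefficient-as-⟦⟧ ((q , u) ∷ x) k with u ≟ₖ k
  ... | yes _ = ≡.cong₂ ℚ._+_ (≡.sym (ℚP.*-identityʳ q)) (coefficient-as-⟦⟧ x k)
  ... | no  _ = ≡.trans (coefficient-as-⟦⟧ x k) (≡.sym (≡.trans (≡.cong (ℚ._+ ⟦ x ⟧ indicator k) (ℚP.*-zeroʳ q))
                                                               (ℚP.+-identityˡ _)))

  coefficient-from-⟦⟧ : ∀ x y → (∀ f → ⟦ x ⟧ f ≡ ⟦ y ⟧ f) → ∀ k → coefficient x k ≡ coefficient y k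
  coefficient-from-⟦⟧ x y x≗y k =
    ≡.trans (coefficient-as-⟦⟧ x k) (≡.trans (x≗y (indicator k)) (≡.sym (coefficient-as-⟦⟧ y k)))

≈H-from-⟦⟧ : ∀ x y → (∀ f → Q.⟦ x ⟧ f ≡ Q.⟦ y ⟧ f) → x ≈H y
≈H-from-⟦⟧ x y x≗y w = ≡.trans (≡.sym (Q.coefficient≡coeff x w))
  (≡.trans (coefficient-from-⟦⟧ (≡-dec ℤ._≟_) x y x≗y w) (Q.coefficient≡coeff y w))

≈₂-from-⟦⟧₂ : ∀ s t → (∀ f → Q.⟦ s ⟧₂ f ≡ Q.⟦ t ⟧₂ f) → s ≈₂ t
≈₂-from-⟦⟧₂ s t s≗t a b = ≡.trans (≡.sym (Q.coefficient₂≡coeff₂ s a b))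
  (≡.trans (coefficient-from-⟦⟧ (×P.≡-dec (≡-dec ℤ._≟_) (≡-dec ℤ._≟_)) s t (λ f → s≗t (λ u v → f (u , v))) (a , b))
           (Q.coefficient₂≡coeff₂ t a b))

-- Identities in H and H ⊗ H

module Identities where
  open Q

  ∗-comm : ∀ x y → x ∗ y ≈H y ∗ x
  ∗-comm x y = ≈H-from-⟦⟧ (x ∗ y) (y ∗ x) λ f → begin
    ⟦ x ∗ y ⟧ f                                  ≈⟨ ⟦∗⟧ x y f ⟩
    ⟦ x ⟧ (λ u → ⟦ y ⟧ (λ v → qshᵗ u v f))        ≈⟨ ⟦⟧-cong x (λ u → ⟦⟧-cong y (λ v → qshᵗ-comm u v f)) ⟩
    ⟦ x ⟧ (λ u → ⟦ y ⟧ (λ v → qshᵗ v u f))        ≈⟨ ⟦⟧-comm x (⟦⟧-isLinear y) (λ u v → qshᵗ v u f) ⟩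
    ⟦ y ⟧ (λ v → ⟦ x ⟧ (λ u → qshᵗ v u f))        ≈⟨ ⟦∗⟧ y x f ⟨
    ⟦ y ∗ x ⟧ f                                  ∎

  scale≈scale𝟙∗ : ∀ q x → scale q x ≈H scale q 𝟙 ∗ x
  scale≈scale𝟙∗ q x = ≈H-from-⟦⟧ (scale q x) (scale q 𝟙 ∗ x) λ f → begin
    ⟦ scale q x ⟧ f                                   ≈⟨ ⟦scale⟧ q x f ⟩
    q ℚ.* ⟦ x ⟧ f                                     ≈⟨ *-congˡ {q} (⟦word⟧ [] (λ u → ⟦ x ⟧ (λ v → qshᵗ u v f))) ⟨
    q ℚ.* ⟦ 𝟙 ⟧ (λ u → ⟦ x ⟧ (λ v → qshᵗ u v f))      ≈⟨ ⟦scale⟧ q 𝟙 (λ u → ⟦ x ⟧ (λ v → qshᵗ u v f)) ⟨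
    ⟦ scale q 𝟙 ⟧ (λ u → ⟦ x ⟧ (λ v → qshᵗ u v f))    ≈⟨ ⟦∗⟧ (scale q 𝟙) x f ⟨
    ⟦ scale q 𝟙 ∗ x ⟧ f                               ∎

  qsh≈word∗word : ∀ u v → qsh u v ≈H word u ∗ word v
  qsh≈word∗word u v = ≈H-from-⟦⟧ (qsh u v) (word u ∗ word v) λ f → begin
    ⟦ qsh u v ⟧ f                                         ≈⟨ ⟦qsh⟧ u v f ⟩
    qshᵗ u v f                                            ≈⟨ ⟦word⟧ v (λ v′ → qshᵗ u v′ f) ⟨
    ⟦ word v ⟧ (λ v′ → qshᵗ u v′ f)                       ≈⟨ ⟦word⟧ u (λ u′ → ⟦ word v ⟧ (λ v′ → qshᵗ u′ v′ f)) ⟨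
    ⟦ word u ⟧ (λ u′ → ⟦ word v ⟧ (λ v′ → qshᵗ u′ v′ f))  ≈⟨ ⟦∗⟧ (word u) (word v) f ⟨
    ⟦ word u ∗ word v ⟧ f                                 ∎

  scaleWord++ : ∀ q w x → scale q (word w) ++ x ≈H (q , w) ∷ x
  scaleWord++ q w x = ≈H-from-⟦⟧ (scale q (word w) ++ x) ((q , w) ∷ x) λ f →
    trans (⟦⟧-++ (scale q (word w)) x f)
          (+-cong {⟦ scale q (word w) ⟧ f} (trans (⟦scale⟧ q (word w) f) (*-congˡ {q} (⟦word⟧ w f))) (refl {⟦ x ⟧ f}))

  []≈H-difference : ∀ {x y} → x ≈H y → [] ≈H (x -H y)
  []≈H-difference {x} {y} x≈y = ≈H-from-⟦⟧ [] (x -H y) λ f → sym (begin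
    ⟦ x -H y ⟧ f          ≈⟨ ⟦⟧-++ x (negH y) f ⟩
    ⟦ x ⟧ f + ⟦ negH y ⟧ f ≈⟨ +-cong (⟦⟧-resp-≈H {x} {y} x≈y f) (⟦negH⟧ y f) ⟩
    ⟦ y ⟧ f + - ⟦ y ⟧ f    ≈⟨ -‿inverseʳ (⟦ y ⟧ f) ⟩
    0#                    ∎)

  S-cong : ∀ {x y} → x ≈H y → S x ≈H S y
  S-cong {x} {y} x≈y = ≈H-from-⟦⟧ (S x) (S y) λ f →
    trans (⟦S⟧ x f) (trans (⟦⟧-resp-≈H {x} {y} x≈y (λ w → Sᵗ w f)) (sym (⟦S⟧ y f)))

  S-++ : ∀ x y → S (x ++ y) ≈H S x ++ S y
  S-++ x y = ≈H-from-⟦⟧ (S (x ++ y)) (S x ++ S y) λ f → begin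
    ⟦ S (x ++ y) ⟧ f                              ≈⟨ ⟦S⟧ (x ++ y) f ⟩
    ⟦ x ++ y ⟧ (λ w → Sᵗ w f)                     ≈⟨ ⟦⟧-++ x y _ ⟩
    ⟦ x ⟧ (λ w → Sᵗ w f) + ⟦ y ⟧ (λ w → Sᵗ w f)   ≈⟨ +-cong (⟦S⟧ x f) (⟦S⟧ y f) ⟨
    ⟦ S x ⟧ f + ⟦ S y ⟧ f                         ≈⟨ ⟦⟧-++ (S x) (S y) f ⟨
    ⟦ S x ++ S y ⟧ f                              ∎

  S-scale : ∀ q x → S (scale q x) ≈H scale q (S x)
  S-scale q x = ≈H-from-⟦⟧ (S (scale q x)) (scale q (S x)) λ f → begin
    ⟦ S (scale q x) ⟧ f               ≈⟨ ⟦S⟧ (scale q x) f ⟩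
    ⟦ scale q x ⟧ (λ w → Sᵗ w f)      ≈⟨ ⟦scale⟧ q x _ ⟩
    q ℚ.* ⟦ x ⟧ (λ w → Sᵗ w f)        ≈⟨ *-congˡ {q} (⟦S⟧ x f) ⟨
    q ℚ.* ⟦ S x ⟧ f                   ≈⟨ ⟦scale⟧ q (S x) f ⟨
    ⟦ scale q (S x) ⟧ f               ∎

  S-∗ : ∀ x y → S (x ∗ y) ≈H S x ∗ S y
  S-∗ x y = ≈H-from-⟦⟧ (S (x ∗ y)) (S x ∗ S y) λ f → begin
    ⟦ S (x ∗ y) ⟧ f                                      ≈⟨ ⟦S⟧ (x ∗ y) f ⟩
    ⟦ x ∗ y ⟧ (λ w → Sᵗ w f)                             ≈⟨ ⟦∗⟧ x y _ ⟩
    ⟦ x ⟧ (λ u → ⟦ y ⟧ (λ v → antipodeOfProduct u v f))  ≈⟨ ⟦⟧-cong x (λ u → ⟦⟧-cong y (λ v → Sᵗ-∗ u v f)) ⟩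
    ⟦ x ⟧ (λ u → ⟦ y ⟧ (λ v → productOfAntipodes u v f)) ≈⟨ ⟦⟧-cong x (λ u →
                                                             ⟦⟧-comm y (⟦⟧-isLinear (Sword u)) (λ v α → Sᵗ v (λ β → qshᵗ α β f))) ⟩
    ⟦ x ⟧ (λ u → Sᵗ u (λ α → ⟦ y ⟧ (λ v → Sᵗ v (λ β → qshᵗ α β f))))
                                                         ≈⟨ ⟦⟧-cong x (λ u → ⟦⟧-cong (Sword u) (λ α → ⟦S⟧ y (λ β → qshᵗ α β f))) ⟨
    ⟦ x ⟧ (λ u → Sᵗ u (λ α → ⟦ S y ⟧ (λ β → qshᵗ α β f))) ≈⟨ ⟦S⟧ x _ ⟨
    ⟦ S x ⟧ (λ α → ⟦ S y ⟧ (λ β → qshᵗ α β f))           ≈⟨ ⟦∗⟧ (S x) (S y) f ⟨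
    ⟦ S x ∗ S y ⟧ f                                      ∎

  Δ-cong : ∀ {x y} → x ≈H y → Δ x ≈₂ Δ y
  Δ-cong {x} {y} x≈y = ≈₂-from-⟦⟧₂ (Δ x) (Δ y) λ f →
    trans (⟦Δ⟧₂ x f) (trans (⟦⟧-resp-≈H {x} {y} x≈y (λ w → ∑split w f)) (sym (⟦Δ⟧₂ y f)))

  Δ-++ : ∀ x y → Δ (x ++ y) ≈₂ Δ x ++ Δ y
  Δ-++ x y = ≈₂-from-⟦⟧₂ (Δ (x ++ y)) (Δ x ++ Δ y) λ f → begin
    ⟦ Δ (x ++ y) ⟧₂ f                                ≈⟨ ⟦Δ⟧₂ (x ++ y) f ⟩
    ⟦ x ++ y ⟧ (λ w → ∑split w f)                    ≈⟨ ⟦⟧-++ x y _ ⟩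
    ⟦ x ⟧ (λ w → ∑split w f) + ⟦ y ⟧ (λ w → ∑split w f) ≈⟨ +-cong (⟦Δ⟧₂ x f) (⟦Δ⟧₂ y f) ⟨
    ⟦ Δ x ⟧₂ f + ⟦ Δ y ⟧₂ f                          ≈⟨ ⟦⟧₂-++ (Δ x) (Δ y) f ⟨
    ⟦ Δ x ++ Δ y ⟧₂ f                                ∎

  Δ-∗ : ∀ x y → Δ (x ∗ y) ≈₂ Δ x ∗₂ Δ y
  Δ-∗ x y = ≈₂-from-⟦⟧₂ (Δ (x ∗ y)) (Δ x ∗₂ Δ y) (⟦Δ∗⟧₂ x y)

  ∗₂-cong : ∀ s {t t′} → t ≈₂ t′ → s ∗₂ t ≈₂ s ∗₂ t′
  ∗₂-cong s {t} {t′} t≈t′ = ≈₂-from-⟦⟧₂ (s ∗₂ t) (s ∗₂ t′) λ f →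
    trans (⟦∗₂⟧₂ s t f) (trans (⟦⟧₂-cong s (λ a b → ⟦⟧₂-resp-≈₂ {t} {t′} t≈t′ (λ c d → qshᵗ a c (λ x → qshᵗ b d (f x))))) (sym (⟦∗₂⟧₂ s t′ f)))

  ∗₂-++ : ∀ s t₁ t₂ → s ∗₂ (t₁ ++ t₂) ≈₂ s ∗₂ t₁ ++ s ∗₂ t₂
  ∗₂-++ s t₁ t₂ = ≈₂-from-⟦⟧₂ (s ∗₂ (t₁ ++ t₂)) (s ∗₂ t₁ ++ s ∗₂ t₂) λ f → begin
    ⟦ s ∗₂ (t₁ ++ t₂) ⟧₂ f                                     ≈⟨ ⟦∗₂⟧₂ s (t₁ ++ t₂) f ⟩
    ⟦ s ⟧₂ (λ a b → ⟦ t₁ ++ t₂ ⟧₂ (G f a b))                       ≈⟨ ⟦⟧₂-cong s (λ a b → ⟦⟧₂-++ t₁ t₂ (G f a b)) ⟩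
    ⟦ s ⟧₂ (λ a b → ⟦ t₁ ⟧₂ (G f a b) + ⟦ t₂ ⟧₂ (G f a b))          ≈⟨ lin-+ (Comb₂.⟦⟧-isLinear s) _ _ ⟩
    ⟦ s ⟧₂ (λ a b → ⟦ t₁ ⟧₂ (G f a b)) + ⟦ s ⟧₂ (λ a b → ⟦ t₂ ⟧₂ (G f a b))
                                                               ≈⟨ +-cong (⟦∗₂⟧₂ s t₁ f) (⟦∗₂⟧₂ s t₂ f) ⟨
    ⟦ s ∗₂ t₁ ⟧₂ f + ⟦ s ∗₂ t₂ ⟧₂ f                            ≈⟨ ⟦⟧₂-++ (s ∗₂ t₁) (s ∗₂ t₂) f ⟨
    ⟦ s ∗₂ t₁ ++ s ∗₂ t₂ ⟧₂ f                                  ∎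
    where
    G : (Word → Word → ℚ) → Word → Word → Word → Word → ℚ
    G f a b c d = qshᵗ a c (λ x → qshᵗ b d (f x))

  ∗₂-[] : ∀ s → s ∗₂ [] ≡ []
  ∗₂-[] []      = ≡.refl
  ∗₂-[] (_ ∷ s) = ∗₂-[] s

open Identities

-- 𝒩 is a Hopf ideal

NSfrom-++ : ∀ j s u v → NSfrom j s (u ++ v) → NSfrom j s u
NSfrom-++ j s []      v _          = tt
NSfrom-++ j s (k ∷ u) v (j<s+k , ns) = j<s+k , NSfrom-++ (suc j) (s ℤ.+ k) u v ns

NonSingular-prefix : ∀ k u v → NonSingular (k ∷ u ++ v) → NonSingular (k ∷ u)
NonSingular-prefix k []       v (k≢1 , _)               = k≢1 , tt
NonSingular-prefix k (k₂ ∷ u) v (k≢1 , (notBad , ns)) = k≢1 , (notBad , NSfrom-++ 3 (k ℤ.+ k₂) u v ns)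

InN-[] : InN []
InN-[] w 0≢0 = contradiction ≡.refl 0≢0

InN-single : ∀ q w → NonSingular w → InN ((q , w) ∷ [])
InN-single q w ns w′ q≢0 with ≡-dec ℤ._≟_ w w′
... | yes ≡.refl = ns
... | no  _      = contradiction ≡.refl q≢0

trim : Lin → Lin
trim x = filter (λ (_ , w) → ¬? (coeff x w ℚ.≟ 0ℚ)) x

module _ {P : Word → Set} (P? : ∀ w → Dec (P w)) where

  coeff-filter : ∀ l w → P w → coeff (filter (λ (_ , u) → P? u) l) w ≡ coeff l w
  coeff-filter []            w pw = ≡.refl
  coeff-filter ((q , u) ∷ l) w pw with P? u
  ... | yes _ with ≡-dec ℤ._≟_ u w
  ...   | yes _ = ≡.cong (q ℚ.+_) (coeff-filter l w pw)
  ...   | no  _ = coeff-filter l w pw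
  coeff-filter ((q , u) ∷ l) w pw | no ¬pu with ≡-dec ℤ._≟_ u w
  ...   | yes ≡.refl = contradiction pw ¬pu
  ...   | no  _      = coeff-filter l w pw

  coeff-filter-¬ : ∀ l w → ¬ P w → coeff (filter (λ (_ , u) → P? u) l) w ≡ 0ℚ
  coeff-filter-¬ []            w ¬pw = ≡.refl
  coeff-filter-¬ ((q , u) ∷ l) w ¬pw with P? u
  ... | no  _  = coeff-filter-¬ l w ¬pw
  ... | yes pu with ≡-dec ℤ._≟_ u w
  ...   | yes ≡.refl = contradiction pu ¬pw
  ...   | no  _      = coeff-filter-¬ l w ¬pw

trim-≈H : ∀ x → trim x ≈H x
trim-≈H x w with coeff x w ℚ.≟ 0ℚ
... | no  c≢0 = coeff-filter (λ u → ¬? (coeff x u ℚ.≟ 0ℚ)) x w c≢0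
... | yes c≡0 = ≡.trans (coeff-filter-¬ (λ u → ¬? (coeff x u ℚ.≟ 0ℚ)) x w (λ c≢0 → c≢0 c≡0)) (≡.sym c≡0)

trim-nonSingular : ∀ x → InN x → All (λ (_ , w) → NonSingular w) (trim x)
trim-nonSingular x x∈N = All.map (λ {(_ , w)} c≢0 → x∈N w c≢0) (AllP.all-filter (λ (_ , w) → ¬? (coeff x w ℚ.≟ 0ℚ)) x)

splits-concatenate : ∀ w → All (λ (u , v) → u ++ v ≡ w) (splits w)
splits-concatenate []      = ≡.refl ∷ []
splits-concatenate (a ∷ w) = ≡.refl ∷ AllP.map⁺ (All.map (≡.cong (a ∷_)) (splits-concatenate w))

properSplits-concatenate : ∀ w → All (λ (u , v) → u ++ v ≡ w) (properSplits w)
properSplits-concatenate []      = []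
properSplits-concatenate (a ∷ w) = ≡.refl ∷ AllP.map⁺ (All.map (≡.cong (a ∷_)) (properSplits-concatenate w))

I⊗H+H⊗I : Lin₂ → Set
I⊗H+H⊗I = InI⊗H+H⊗I Inℐ

I⊗H+H⊗I-concatMap : ∀ {X : Set} (g : X → Lin₂) xs → All (λ x → I⊗H+H⊗I (g x)) xs → I⊗H+H⊗I (concatMap g xs)
I⊗H+H⊗I-concatMap g []       []         = zero₂
I⊗H+H⊗I-concatMap g (x ∷ xs) (gx ∷ gxs) = add₂ gx (I⊗H+H⊗I-concatMap g xs gxs)

∗₂-⊗ : ∀ s x y → s ∗₂ (x ⊗ y) ≈₂ concatMap (λ (p , a , b) → (scale p (word a) ∗ x) ⊗ (word b ∗ y)) s
∗₂-⊗ s x y = ≈₂-from-⟦⟧₂ (s ∗₂ (x ⊗ y)) (concatMap (λ (p , a , b) → (scale p (word a) ∗ x) ⊗ (word b ∗ y)) s) λ f → begin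
  ⟦ s ∗₂ (x ⊗ y) ⟧₂ f
    ≈⟨ ⟦∗₂⟧₂ s (x ⊗ y) f ⟩
  ⟦ s ⟧₂ (λ a b → ⟦ x ⊗ y ⟧₂ (λ c d → qshᵗ a c (λ u → qshᵗ b d (f u))))
    ≡⟨ Q.Comb₂.⟦⟧-as-∑ s _ ⟩
  ∑ s (λ (p , a , b) → p ℚ.* ⟦ x ⊗ y ⟧₂ (λ c d → qshᵗ a c (λ u → qshᵗ b d (f u))))
    ≈⟨ ∑-cong s (λ (p , a , b) → sym (term p a b f)) ⟩
  ∑ s (λ (p , a , b) → ⟦ (scale p (word a) ∗ x) ⊗ (word b ∗ y) ⟧₂ f)
    ≈⟨ Q.Comb₂.⟦⟧-concatMap _ s _ ⟨
  ⟦ concatMap (λ (p , a , b) → (scale p (word a) ∗ x) ⊗ (word b ∗ y)) s ⟧₂ f ∎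
  where
  open Q
  term : ∀ p a b f → ⟦ (scale p (word a) ∗ x) ⊗ (word b ∗ y) ⟧₂ f
                   ≡ p ℚ.* ⟦ x ⊗ y ⟧₂ (λ c d → qshᵗ a c (λ u → qshᵗ b d (f u)))
  term p a b f = begin
    ⟦ (scale p (word a) ∗ x) ⊗ (word b ∗ y) ⟧₂ f
      ≈⟨ ⟦⊗⟧₂ (scale p (word a) ∗ x) (word b ∗ y) f ⟩
    ⟦ scale p (word a) ∗ x ⟧ (λ u → ⟦ word b ∗ y ⟧ (f u))
      ≈⟨ ⟦∗⟧ (scale p (word a)) x _ ⟩
    ⟦ scale p (word a) ⟧ (λ a′ → ⟦ x ⟧ (λ c → qshᵗ a′ c (λ u → ⟦ word b ∗ y ⟧ (f u))))
      ≈⟨ ⟦scale⟧ p (word a) (λ a′ → ⟦ x ⟧ (λ c → qshᵗ a′ c (λ u → ⟦ word b ∗ y ⟧ (f u)))) ⟩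
    p ℚ.* ⟦ word a ⟧ (λ a′ → ⟦ x ⟧ (λ c → qshᵗ a′ c (λ u → ⟦ word b ∗ y ⟧ (f u))))
      ≈⟨ *-congˡ {p} (⟦word⟧ a (λ a′ → ⟦ x ⟧ (λ c → qshᵗ a′ c (λ u → ⟦ word b ∗ y ⟧ (f u))))) ⟩
    p ℚ.* ⟦ x ⟧ (λ c → qshᵗ a c (λ u → ⟦ word b ∗ y ⟧ (f u)))
      ≈⟨ *-congˡ {p} (⟦⟧-cong x (λ c → qshᵗ-cong a c (λ u → trans (⟦∗⟧ (word b) y (f u)) (⟦word⟧ b (λ b′ → ⟦ y ⟧ (λ d → qshᵗ b′ d (f u))))))) ⟩
    p ℚ.* ⟦ x ⟧ (λ c → qshᵗ a c (λ u → ⟦ y ⟧ (λ d → qshᵗ b d (f u))))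
      ≈⟨ *-congˡ {p} (⟦⟧-cong x (λ c → sym (⟦⟧-comm y (qshᵗ-isLinear a c) (λ d u → qshᵗ b d (f u))))) ⟩
    p ℚ.* ⟦ x ⟧ (λ c → ⟦ y ⟧ (λ d → qshᵗ a c (λ u → qshᵗ b d (f u))))
      ≈⟨ *-congˡ {p} (⟦⊗⟧₂ x y (λ c d → qshᵗ a c (λ u → qshᵗ b d (f u)))) ⟨
    p ℚ.* ⟦ x ⊗ y ⟧₂ (λ c d → qshᵗ a c (λ u → qshᵗ b d (f u))) ∎

∗₂-closed : ∀ s {t} → I⊗H+H⊗I t → I⊗H+H⊗I (s ∗₂ t)
∗₂-closed s zero₂ = ≡.subst I⊗H+H⊗I (≡.sym (∗₂-[] s)) zero₂
∗₂-closed s (left {x} x∈I y) =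
  resp₂ (λ a b → ≡.sym (∗₂-⊗ s x y a b))
        (I⊗H+H⊗I-concatMap _ s (All.universal (λ (p , a , b) → left (mulL (scale p (word a)) x∈I) (word b ∗ y)) s))
∗₂-closed s (right {y} x y∈I) =
  resp₂ (λ a b → ≡.sym (∗₂-⊗ s x y a b))
        (I⊗H+H⊗I-concatMap _ s (All.universal (λ (p , a , b) → right (scale p (word a) ∗ x) (mulL (word b) y∈I)) s))
∗₂-closed s (add₂ {t₁} {t₂} t₁∈ t₂∈) =
  resp₂ (λ a b → ≡.sym (∗₂-++ s t₁ t₂ a b)) (add₂ (∗₂-closed s t₁∈) (∗₂-closed s t₂∈))
∗₂-closed s (resp₂ {t} {t′} t≈t′ t∈) = resp₂ (∗₂-cong s {t} {t′} t≈t′) (∗₂-closed s t∈)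

Δ∗-closed : ∀ a x → I⊗H+H⊗I (Δ x) → I⊗H+H⊗I (Δ (a ∗ x))
Δ∗-closed a x Δx∈ = resp₂ (λ u v → ≡.sym (Δ-∗ a x u v)) (∗₂-closed (Δ a) Δx∈)

Δ-term-closed : ∀ q w → NonSingular w → I⊗H+H⊗I (map (λ (u , v) → (q , u , v)) (splits w))
Δ-term-closed q w ns = go (splits w) (splits-concatenate w)
  where
  entry : ∀ u v → NonSingular (u ++ v) → I⊗H+H⊗I ((q , u , v) ∷ [])
  entry []      v ns = ≡.subst (λ r → I⊗H+H⊗I ((r , [] , v) ∷ [])) (ℚP.*-identityˡ q)
                         (right 𝟙 (gen (InN-single q v ns)))
  entry (k ∷ u) v ns = ≡.subst (λ r → I⊗H+H⊗I ((r , k ∷ u , v) ∷ [])) (ℚP.*-identityʳ q)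
                         (left (gen (InN-single q (k ∷ u) (NonSingular-prefix k u v ns))) (word v))
  go : ∀ l → All (λ (u , v) → u ++ v ≡ w) l → I⊗H+H⊗I (map (λ (u , v) → (q , u , v)) l)
  go []            []         = zero₂
  go ((u , v) ∷ l) (uv≡w ∷ l≡) = add₂ (entry u v (≡.subst NonSingular (≡.sym uv≡w) ns)) (go l l≡)

Δ-closed : ∀ {x} → Inℐ x → I⊗H+H⊗I (Δ x)
Δ-closed (gen {x} x∈N) =
  resp₂ (Δ-cong {trim x} {x} (trim-≈H x))
        (I⊗H+H⊗I-concatMap _ (trim x) (All.map (λ {(q , w)} ns → Δ-term-closed q w ns) (trim-nonSingular x x∈N)))
Δ-closed (add {x} {y} x∈ y∈)  = resp₂ (λ a b → ≡.sym (Δ-++ x y a b)) (add₂ (Δ-closed x∈) (Δ-closed y∈))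
Δ-closed (smul {x} q x∈)      = resp₂ (Δ-cong {scale q 𝟙 ∗ x} {scale q x} (λ w → ≡.sym (scale≈scale𝟙∗ q x w))) (Δ∗-closed (scale q 𝟙) x (Δ-closed x∈))
Δ-closed (mulL {x} a x∈)      = Δ∗-closed a x (Δ-closed x∈)
Δ-closed (mulR {x} a x∈)      = resp₂ (Δ-cong {a ∗ x} {x ∗ a} (∗-comm a x)) (Δ∗-closed a x (Δ-closed x∈))
Δ-closed (resp {x} {y} x≈y x∈) = resp₂ (Δ-cong {x} {y} x≈y) (Δ-closed x∈)

Inℐ-concatMap : ∀ {X : Set} (g : X → Lin) xs → All (λ x → Inℐ (g x)) xs → Inℐ (concatMap g xs)
Inℐ-concatMap g []       []         = gen InN-[]
Inℐ-concatMap g (x ∷ xs) (gx ∷ gxs) = add gx (Inℐ-concatMap g xs gxs)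

Sfuel-closed : ∀ k w → NonSingular w → Inℐ (Sfuel k w)
Sfuel-closed k       []      ()
Sfuel-closed ℕ.zero  (a ∷ w) ns = gen InN-[]
Sfuel-closed (suc k) (a ∷ w) ns =
  smul (ℚ.- 1ℚ) (Inℐ-concatMap _ (properSplits (a ∷ w))
    (All.map (λ {(u , v)} uv≡aw → term u v (≡.subst NonSingular (≡.sym uv≡aw) ns)) (properSplits-concatenate (a ∷ w))))
  where
  term : ∀ u v → NonSingular (u ++ v) → Inℐ (Sfuel k u ∗ word v)
  term []      v ns = mulL 𝟙 (gen (InN-single 1ℚ v ns))
  term (b ∷ u) v ns = mulR (word v) (Sfuel-closed k (b ∷ u) (NonSingular-prefix b u v ns))

S-closed : ∀ {x} → Inℐ x → Inℐ (S x)
S-closed (gen {x} x∈N) =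
  resp (S-cong {trim x} {x} (trim-≈H x))
       (Inℐ-concatMap _ (trim x) (All.map (λ {(q , w)} ns → smul q (Sfuel-closed (length w) w ns)) (trim-nonSingular x x∈N)))
S-closed (add {x} {y} x∈ y∈)     = resp (λ w → ≡.sym (S-++ x y w)) (add (S-closed x∈) (S-closed y∈))
S-closed (smul {x} q x∈)         = resp (λ w → ≡.sym (S-scale q x w)) (smul q (S-closed x∈))
S-closed (mulL {x} a x∈)         = resp (λ w → ≡.sym (S-∗ a x w)) (mulL (S a) (S-closed x∈))
S-closed (mulR {x} a x∈)         = resp (λ w → ≡.sym (S-∗ x a w)) (mulR (S a) (S-closed x∈))
S-closed (resp {x} {y} x≈y x∈)   = resp (S-cong {x} {y} x≈y) (S-closed x∈)

-- Characters, transfer characters and characters of H/𝒩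

module Characters {c ℓ : Level} (A : QAlgebra c ℓ) where
  open Pairing A

  qshᵗ-character : ∀ {φ} → IsCharH A φ → ∀ u v → qshᵗ u v φ ≈ φ u * φ v
  qshᵗ-character {φ} (_ , φ-∗) u v = trans (sym (⟦qsh⟧ u v φ)) (trans (reflexive (≡.sym (ext≡⟦⟧ φ (qsh u v)))) (φ-∗ u v))

  character-∗-character : ∀ {φ ψ} → IsCharH A φ → IsCharH A ψ → ∀ u₁ u₂ v₁ v₂ →
    qshᵗ u₁ v₁ (λ a → qshᵗ u₂ v₂ (λ b → φ a * ψ b)) ≈ (φ u₁ * ψ u₂) * (φ v₁ * ψ v₂)
  character-∗-character {φ} {ψ} φ-char ψ-char u₁ u₂ v₁ v₂ = begin
    qshᵗ u₁ v₁ (λ a → qshᵗ u₂ v₂ (λ b → φ a * ψ b))  ≈⟨ qshᵗ-cong u₁ v₁ (λ a → lin-* (qshᵗ-isLinear u₂ v₂) (φ a) ψ) ⟩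
    qshᵗ u₁ v₁ (λ a → φ a * qshᵗ u₂ v₂ ψ)            ≈⟨ lin-*ʳ (qshᵗ-isLinear u₁ v₁) _ φ ⟩
    qshᵗ u₁ v₁ φ * qshᵗ u₂ v₂ ψ                      ≈⟨ *-cong (qshᵗ-character φ-char u₁ v₁) (qshᵗ-character ψ-char u₂ v₂) ⟩
    (φ u₁ * φ v₁) * (ψ u₂ * ψ v₂)                    ≈⟨ *-interchange _ _ _ _ ⟩
    (φ u₁ * ψ u₂) * (φ v₁ * ψ v₂)                    ∎

  ⟦∗⟧-character : ∀ {φ} → IsCharH A φ → ∀ x y → ⟦ x ∗ y ⟧ φ ≈ ⟦ x ⟧ φ * ⟦ y ⟧ φ
  ⟦∗⟧-character {φ} φ-char x y = begin
    ⟦ x ∗ y ⟧ φ                          ≈⟨ ⟦∗⟧ x y φ ⟩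
    ⟦ x ⟧ (λ u → ⟦ y ⟧ (λ v → qshᵗ u v φ)) ≈⟨ ⟦⟧-cong x (λ u → ⟦⟧-cong y (λ v → qshᵗ-character φ-char u v)) ⟩
    ⟦ x ⟧ (λ u → ⟦ y ⟧ (λ v → φ u * φ v))  ≈⟨ ⟦⟧-cong x (λ u → lin-* (⟦⟧-isLinear y) (φ u) φ) ⟩
    ⟦ x ⟧ (λ u → φ u * ⟦ y ⟧ φ)            ≈⟨ lin-*ʳ (⟦⟧-isLinear x) _ φ ⟩
    ⟦ x ⟧ φ * ⟦ y ⟧ φ                      ∎

  ⟦⟧-vanish-on-𝒩 : ∀ {φ} → IsTransfer A φ → ∀ {x} → Inℐ x → ⟦ x ⟧ φ ≈ 0#
  ⟦⟧-vanish-on-𝒩 {φ} (_ , φ-N) (gen {x} x∈N) =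
    trans (⟦⟧-resp-≈H {x} {trim x} (λ w → ≡.sym (trim-≈H x w)) φ) (vanish (trim x) (trim-nonSingular x x∈N))
    where
    vanish : ∀ x → All (λ (_ , w) → NonSingular w) x → ⟦ x ⟧ φ ≈ 0#
    vanish []            []        = refl
    vanish ((q , w) ∷ x) (ns ∷ x∈) = trans (+-cong (trans (*-congˡ (φ-N w ns)) (zeroʳ _)) (vanish x x∈)) (+-identityʳ 0#)
  ⟦⟧-vanish-on-𝒩 {φ} φ-T (add {x} {y} x∈ y∈) =
    trans (⟦⟧-++ x y φ) (trans (+-cong (⟦⟧-vanish-on-𝒩 φ-T x∈) (⟦⟧-vanish-on-𝒩 φ-T y∈)) (+-identityʳ 0#))
  ⟦⟧-vanish-on-𝒩 {φ} φ-T (smul {x} q x∈) =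
    trans (⟦scale⟧ q x φ) (trans (*-congˡ (⟦⟧-vanish-on-𝒩 φ-T x∈)) (zeroʳ _))
  ⟦⟧-vanish-on-𝒩 {φ} φ-T (mulL {x} a x∈) =
    trans (⟦∗⟧-character (proj₁ φ-T) a x) (trans (*-congˡ (⟦⟧-vanish-on-𝒩 φ-T x∈)) (zeroʳ _))
  ⟦⟧-vanish-on-𝒩 {φ} φ-T (mulR {x} a x∈) =
    trans (⟦∗⟧-character (proj₁ φ-T) x a) (trans (*-congʳ (⟦⟧-vanish-on-𝒩 φ-T x∈)) (zeroˡ _))
  ⟦⟧-vanish-on-𝒩 {φ} φ-T (resp {x} {y} x≈y x∈) =
    trans (sym (⟦⟧-resp-≈H {x} {y} x≈y φ)) (⟦⟧-vanish-on-𝒩 φ-T x∈)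

counit-isTransfer : IsTransfer ℚ-algebra Q.counit
counit-isTransfer = (≡.refl , counit-∗) , λ { (_ ∷ _) _ → ≡.refl }
  where
  open Q
  counit-∗ : ∀ u v → ext ℚ-algebra counit (qsh u v) ≡ counit u ℚ.* counit v
  counit-∗ u v = begin
    ext ℚ-algebra counit (qsh u v)   ≡⟨ ext≡⟦⟧ counit (qsh u v) ⟩
    ⟦ qsh u v ⟧ counit               ≈⟨ ⟦qsh⟧ u v counit ⟩
    qshᵗ u v counit                  ≈⟨ qshᵗ-cong u v (λ t → sym (*-identityʳ (counit t))) ⟩
    qshᵗ u v (λ t → counit t * 1#)   ≈⟨ qshᵗ-counit u v 1# ⟩
    counit u * (counit v * 1#)       ≈⟨ *-congˡ {counit u} (*-identityʳ (counit v)) ⟩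
    counit u * counit v              ∎

ε-vanish-on-𝒩 : ∀ {x} → Inℐ x → ε x ≡ 0ℚ
ε-vanish-on-𝒩 {x} x∈ = begin
  coeff x []                               ≡⟨ Q.coefficient≡coeff x [] ⟨
  Q.coefficient x []                       ≡⟨ coefficient-as-⟦⟧ (≡-dec ℤ._≟_) x [] ⟩
  Q.⟦ x ⟧ indicator (≡-dec ℤ._≟_) []       ≡⟨ Q.⟦⟧-cong x indicator-[] ⟩
  Q.⟦ x ⟧ Q.counit                         ≡⟨ Characters.⟦⟧-vanish-on-𝒩 ℚ-algebra counit-isTransfer x∈ ⟩
  0ℚ                                       ∎
  where
  open ≡.≡-Reasoning
  indicator-[] : ∀ u → indicator (≡-dec ℤ._≟_) [] u ≡ Q.counit u
  indicator-[] []      = ≡.refl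
  indicator-[] (_ ∷ _) = ≡.refl

𝒩-isHopfIdeal : IsHopfIdeal Inℐ
𝒩-isHopfIdeal = record
  { isIdeal   = record
    { respects  = λ {x} {y} → resp {x} {y}
    ; has-zero  = gen InN-[]
    ; closed-+  = add
    ; closed-·  = smul
    ; closed-∗ˡ = mulL
    ; closed-∗ʳ = mulR
    }
  ; coideal-Δ = Δ-closed
  ; coideal-ε = ε-vanish-on-𝒩
  ; antipode  = S-closed
  }

module Transfer {c ℓ : Level} (A : QAlgebra c ℓ) where
  open Pairing A
  open Characters A

  conv-as-∑split : ∀ φ ψ w → conv A φ ψ w ≡ ∑split w (λ a b → φ a * ψ b)
  conv-as-∑split φ ψ w = ≡.trans (foldr-as-∑ (λ (a , b) → φ a * ψ b) (splits w)) (∑-splits w (λ a b → φ a * ψ b))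

  convQ-as-⟦Δ⟧₂ : ∀ χ ψ x → convQ A χ ψ x ≡ ⟦ Δ x ⟧₂ (λ u v → χ (word u) * ψ (word v))
  convQ-as-⟦Δ⟧₂ χ ψ x = ≡.trans (foldr-as-∑ _ (Δ x)) (≡.sym (Comb₂.⟦⟧-as-∑ (Δ x) _))

  conv-multiplicative : ∀ {φ ψ} → IsCharH A φ → IsCharH A ψ → ∀ u v →
                        ext A (conv A φ ψ) (qsh u v) ≈ conv A φ ψ u * conv A φ ψ v
  conv-multiplicative {φ} {ψ} φ-char ψ-char u v = begin
    ext A (conv A φ ψ) (qsh u v)
      ≡⟨ ext≡⟦⟧ (conv A φ ψ) (qsh u v) ⟩
    ⟦ qsh u v ⟧ (conv A φ ψ)
      ≈⟨ trans (⟦qsh⟧ u v _) (qshᵗ-cong u v (λ t → reflexive (conv-as-∑split φ ψ t))) ⟩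
    qshᵗ u v (λ t → ∑split t (λ a b → φ a * ψ b))
      ≈⟨ qshᵗ-∑split u v (λ a b → φ a * ψ b) ⟩
    ∑split u (λ u₁ u₂ → ∑split v (λ v₁ v₂ → qshᵗ u₁ v₁ (λ a → qshᵗ u₂ v₂ (λ b → φ a * ψ b))))
      ≈⟨ ∑split-cong u (λ u₁ u₂ → ∑split-cong v (λ v₁ v₂ → character-∗-character φ-char ψ-char u₁ u₂ v₁ v₂)) ⟩
    ∑split u (λ u₁ u₂ → ∑split v (λ v₁ v₂ → (φ u₁ * ψ u₂) * (φ v₁ * ψ v₂)))
      ≈⟨ ∑split-cong u (λ u₁ u₂ → ∑split-*ˡ v (φ u₁ * ψ u₂) (λ v₁ v₂ → φ v₁ * ψ v₂)) ⟩
    ∑split u (λ u₁ u₂ → (φ u₁ * ψ u₂) * ∑split v (λ v₁ v₂ → φ v₁ * ψ v₂))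
      ≈⟨ ∑split-*ʳ u _ (λ u₁ u₂ → φ u₁ * ψ u₂) ⟩
    ∑split u (λ u₁ u₂ → φ u₁ * ψ u₂) * ∑split v (λ v₁ v₂ → φ v₁ * ψ v₂)
      ≡⟨ ≡.cong₂ _*_ (conv-as-∑split φ ψ u) (conv-as-∑split φ ψ v) ⟨
    conv A φ ψ u * conv A φ ψ v ∎

  conv-vanish : ∀ {φ ψ} → (∀ w → NonSingular w → φ w ≈ 0#) → (∀ w → NonSingular w → ψ w ≈ 0#) →
                ∀ w → NonSingular w → conv A φ ψ w ≈ 0#
  conv-vanish {φ} {ψ} φ-N ψ-N (k ∷ w) ns = begin
    conv A φ ψ (k ∷ w)
      ≡⟨ conv-as-∑split φ ψ (k ∷ w) ⟩
    φ [] * ψ (k ∷ w) + ∑split w (λ a b → φ (k ∷ a) * ψ b)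
      ≈⟨ +-cong (trans (*-congˡ (ψ-N (k ∷ w) ns)) (zeroʳ _))
                (∑split-vanish w (λ a b ab≡w → trans (*-congʳ (φ-N (k ∷ a) (prefix a b ab≡w))) (zeroˡ _))) ⟩
    0# + 0#
      ≈⟨ +-identityʳ 0# ⟩
    0# ∎
    where
    prefix : ∀ a b → a ++ b ≡ w → NonSingular (k ∷ a)
    prefix a b ab≡w = NonSingular-prefix k a b (≡.subst (λ w′ → NonSingular (k ∷ w′)) (≡.sym ab≡w) ns)

  conv-isTransfer : ∀ φ ψ → IsTransfer A φ → IsTransfer A ψ → IsTransfer A (conv A φ ψ)
  conv-isTransfer φ ψ (φ-char@(φ-1 , _) , φ-N) (ψ-char@(ψ-1 , _) , ψ-N) =
    (unit , conv-multiplicative φ-char ψ-char) , conv-vanish φ-N ψ-N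
    where
    unit : conv A φ ψ [] ≈ 1#
    unit = trans (+-identityʳ _) (trans (*-cong φ-1 ψ-1) (*-identityˡ 1#))

  ext-isQuotChar : ∀ {φ} → IsTransfer A φ → IsQuotChar A (ext A φ)
  ext-isQuotChar {φ} φ-T@((φ-1 , _) , _) = record
    { well-defined   = λ x y x-y∈ → x-y≈0⇒x≈y _ _ (begin
        ext A φ x + - ext A φ y        ≡⟨ ≡.cong₂ (λ a b → a + - b) (ext≡⟦⟧ φ x) (ext≡⟦⟧ φ y) ⟩
        ⟦ x ⟧ φ + - ⟦ y ⟧ φ            ≈⟨ +-cong refl (⟦negH⟧ y φ) ⟨
        ⟦ x ⟧ φ + ⟦ negH y ⟧ φ          ≈⟨ ⟦⟧-++ x (negH y) φ ⟨
        ⟦ x -H y ⟧ φ                   ≈⟨ ⟦⟧-vanish-on-𝒩 φ-T x-y∈ ⟩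
        0#                             ∎)
    ; additive       = λ x y → via (x ++ y) (⟦⟧-++ x y φ) (≡.cong₂ _+_ (ext≡⟦⟧ φ x) (ext≡⟦⟧ φ y))
    ; homogeneous    = λ q x → via (scale q x) (⟦scale⟧ q x φ) (≡.cong (ι q *_) (ext≡⟦⟧ φ x))
    ; unital         = trans (⟦word⟧ [] φ) φ-1
    ; multiplicative = λ x y → via (x ∗ y) (⟦∗⟧-character (proj₁ φ-T) x y) (≡.cong₂ _*_ (ext≡⟦⟧ φ x) (ext≡⟦⟧ φ y))
    }
    where
    via : ∀ x {r s} → ⟦ x ⟧ φ ≈ r → s ≡ r → ext A φ x ≈ s
    via x ⟦x⟧≈r s≡r = trans (reflexive (ext≡⟦⟧ φ x)) (trans ⟦x⟧≈r (reflexive (≡.sym s≡r)))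

  IsQuotChar-resp : ∀ {χ ψ} → IsQuotChar A χ → (∀ x → ψ x ≈ χ x) → IsQuotChar A ψ
  IsQuotChar-resp {χ} {ψ} χ-char ψ≈χ = record
    { well-defined   = λ x y x-y∈ → trans (ψ≈χ x) (trans (well-defined x y x-y∈) (sym (ψ≈χ y)))
    ; additive       = λ x y → trans (ψ≈χ (x ++ y)) (trans (additive x y) (sym (+-cong (ψ≈χ x) (ψ≈χ y))))
    ; homogeneous    = λ q x → trans (ψ≈χ (scale q x)) (trans (homogeneous q x) (sym (*-congˡ (ψ≈χ x))))
    ; unital         = trans (ψ≈χ 𝟙) unital
    ; multiplicative = λ x y → trans (ψ≈χ (x ∗ y)) (trans (multiplicative x y) (sym (*-cong (ψ≈χ x) (ψ≈χ y))))
    }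
    where open IsQuotChar χ-char

  module Restriction {χ} (χ-char : IsQuotChar A χ) where
    open IsQuotChar χ-char

    restriction : Word → Carrier
    restriction w = χ (word w)

    χ-resp-≈H : ∀ {x y} → x ≈H y → χ x ≈ χ y
    χ-resp-≈H {x} {y} x≈y = well-defined x y (resp {[]} {x -H y} ([]≈H-difference {x} {y} x≈y) (gen InN-[]))

    χ-[] : χ [] ≈ 0#
    χ-[] = +-identityʳ-unique (χ []) (χ []) (sym (additive [] []))

    ext-restriction : ∀ x → ext A restriction x ≈ χ x
    ext-restriction x = trans (reflexive (ext≡⟦⟧ restriction x)) (go x)
      where
      go : ∀ x → ⟦ x ⟧ restriction ≈ χ x
      go []            = sym χ-[]
      go ((q , w) ∷ x) = begin
        ι q * χ (word w) + ⟦ x ⟧ restriction  ≈⟨ +-cong (homogeneous q (word w)) (sym (go x)) ⟨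
        χ (scale q (word w)) + χ x            ≈⟨ additive (scale q (word w)) x ⟨
        χ (scale q (word w) ++ x)             ≈⟨ χ-resp-≈H {scale q (word w) ++ x} {(q , w) ∷ x} (scaleWord++ q w x) ⟩
        χ ((q , w) ∷ x)                       ∎

    restriction-isTransfer : IsTransfer A restriction
    restriction-isTransfer = (unital , multiplicative-on-words) , vanish
      where
      multiplicative-on-words : ∀ u v → ext A restriction (qsh u v) ≈ restriction u * restriction v
      multiplicative-on-words u v = begin
        ext A restriction (qsh u v)  ≈⟨ ext-restriction (qsh u v) ⟩
        χ (qsh u v)                  ≈⟨ χ-resp-≈H {qsh u v} {word u ∗ word v} (qsh≈word∗word u v) ⟩
        χ (word u ∗ word v)          ≈⟨ multiplicative (word u) (word v) ⟩
        χ (word u) * χ (word v)      ∎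
      vanish : ∀ w → NonSingular w → restriction w ≈ 0#
      vanish w ns = trans (well-defined (word w) [] (gen (InN-single 1ℚ w ns))) χ-[]

  convQ-as-ext-conv : ∀ χ ψ x → convQ A χ ψ x ≈ ext A (conv A (λ w → χ (word w)) (λ w → ψ (word w))) x
  convQ-as-ext-conv χ ψ x = begin
    convQ A χ ψ x                                             ≡⟨ convQ-as-⟦Δ⟧₂ χ ψ x ⟩
    ⟦ Δ x ⟧₂ (λ u v → χ (word u) * ψ (word v))                ≈⟨ ⟦Δ⟧₂ x _ ⟩
    ⟦ x ⟧ (λ w → ∑split w (λ u v → χ (word u) * ψ (word v)))  ≈⟨ ⟦⟧-cong x (λ w → reflexive (conv-as-∑split _ _ w)) ⟨
    ⟦ x ⟧ (conv A (λ w → χ (word w)) (λ w → ψ (word w)))      ≡⟨ ext≡⟦⟧ _ x ⟨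
    ext A (conv A (λ w → χ (word w)) (λ w → ψ (word w))) x    ∎

  ext-conv : ∀ φ ψ x → ext A (conv A φ ψ) x ≈ convQ A (ext A φ) (ext A ψ) x
  ext-conv φ ψ x = begin
    ext A (conv A φ ψ) x                                    ≡⟨ ext≡⟦⟧ (conv A φ ψ) x ⟩
    ⟦ x ⟧ (conv A φ ψ)                                      ≈⟨ ⟦⟧-cong x (λ w → reflexive (conv-as-∑split φ ψ w)) ⟩
    ⟦ x ⟧ (λ w → ∑split w (λ u v → φ u * ψ v))              ≈⟨ ⟦Δ⟧₂ x _ ⟨
    ⟦ Δ x ⟧₂ (λ u v → φ u * ψ v)                            ≈⟨ ⟦⟧₂-cong (Δ x) (λ u v → *-cong (⟦word⟧ u φ) (⟦word⟧ v ψ)) ⟨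
    ⟦ Δ x ⟧₂ (λ u v → ext A φ (word u) * ext A ψ (word v))  ≡⟨ convQ-as-⟦Δ⟧₂ (ext A φ) (ext A ψ) x ⟨
    convQ A (ext A φ) (ext A ψ) x                           ∎

  transferIso : TransferIso A
  transferIso = record
    { T-closed  = conv-isTransfer
    ; C-closed  = λ χ ψ χ-char ψ-char →
        IsQuotChar-resp (ext-isQuotChar (conv-isTransfer _ _ (R.restriction-isTransfer χ-char) (R.restriction-isTransfer ψ-char)))
                        (convQ-as-ext-conv χ ψ)
    ; to        = λ (φ , φ-T) → ext A φ , ext-isQuotChar φ-T
    ; from      = λ (χ , χ-char) → R.restriction χ-char , R.restriction-isTransfer χ-char
    ; to-cong   = λ (φ , _) (ψ , _) φ≈ψ x →
        trans (reflexive (ext≡⟦⟧ φ x)) (trans (⟦⟧-cong x φ≈ψ) (reflexive (≡.sym (ext≡⟦⟧ ψ x))))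
    ; from-cong = λ _ _ χ≈ψ w → χ≈ψ (word w)
    ; from-to   = λ (φ , _) w → ⟦word⟧ w φ
    ; to-from   = λ (χ , χ-char) → R.ext-restriction χ-char
    ; to-hom    = λ φ ψ _ _ x → ext-conv φ ψ x
    }
    where module R = Restriction

mainTheorem4 : ∀ {c ℓ : Level} (A : QAlgebra c ℓ) → IsHopfIdeal Inℐ × TransferIso A
mainTheorem4 A = 𝒩-isHopfIdeal , Transfer.transferIso A
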